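{- Let $r\ge 3$ and $1\le s\le r-1$ be integers. Then the automorphism group of the split Praeger-Xu graph $\mathrm{sC}(r,s)$ equals $H$ (acting on $\mathrm{sC}(r,s)$ as described in the context), and $H$ acts transitively on the vertex set of $\mathrm{sC}(r,s)$.
   Context: Praeger-Xu graph $\mathrm{C}(r,s)$ ($r\ge3$, $1\le s\le r-1$): vertices are pairs $(x;\varepsilon_0\varepsilon_1\cdots\varepsilon_{s-1})$ with $x\in\mathbb{Z}_r$ and $\varepsilon_i\in\mathbb{Z}_2$; for a string $h\in\mathbb{Z}_2^{s-1}$ and $\varepsilon\in\mathbb{Z}_2$, the vertex $(x;\varepsilon h)$ is adjacent to $(x+1;h0)$ and $(x+1;h1)$ (and these are all the edges, taken undirected). It is a connected $4$-valent graph on $r2^s$ vertices. The group $H$ is generated by the following permutations of $V\mathrm{C}(r,s)$, which are automorphisms: for $i\in\mathbb{Z}_r$, $\tau_i$ changes $\varepsilon_j$ to $1-\varepsilon_j$ in $(x;\varepsilon_0\cdots\varepsilon_{s-1})$ whenever $x+j\equiv i\pmod r$ (and otherwise fixes the vertex); $\rho:(x;\varepsilon_0\cdots\varepsilon_{s-1})\mapsto(x+1;\varepsilon_0\cdots\varepsilon_{s-1})$; $\sigma:(x;\varepsilon_0\cdots\varepsilon_{s-1})\mapsto(-x-s+1;\varepsilon_{s-1}\cdots\varepsilon_0)$. Thus $H=K\langle\rho,\sigma\rangle$ with $K=\langle\tau_i: i\in\mathbb{Z}_r\rangle\cong C_2^r$, and $H\cong C_2\,\mathrm{wr}\,D_r$.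 Let $\mathcal{S}$ be the partition of $E\mathrm{C}(r,s)$ into the $4$-cycles $(x;0h)\sim(x+1;h0)\sim(x;1h)\sim(x+1;h1)\sim(x;0h)$, $x\in\mathbb{Z}_r$, $h\in\mathbb{Z}_2^{s-1}$. Splitting: for a $4$-valent graph $\Delta$ and a partition $\mathcal{C}$ of $E\Delta$ into cycles, $\mathrm{s}(\Delta,\mathcal{C})$ has vertex set $\{(\alpha,C): C\in\mathcal{C},\ \alpha\in VC\}$, with $(\alpha,C)\sim(\beta,D)$ iff either $C\ne D$ and $\alpha=\beta$, or $C=D$ and $\alpha\sim\beta$ in $\Delta$. The split Praeger-Xu graph is $\mathrm{sC}(r,s)=\mathrm{s}(\mathrm{C}(r,s),\mathcal{S})$. The group $H$ preserves $\mathcal{S}$ and acts on $\mathrm{sC}(r,s)$ by $(\alpha,C)^g=(\alpha^g,C^g)$. -}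

module Defs where

open import Data.Nat using (ℕ; zero; suc; _+_; _∸_; NonZero; _%_)
open import Data.Nat.DivMod using (m%n<n)
open import Data.Fin using (Fin; toℕ; fromℕ<)
import Data.Fin.Properties as FinP
open import Data.Bool using (Bool; true; false; not; if_then_else_; T; _∧_; _∨_)
import Data.Bool.Properties as BoolP
open import Data.Vec using (Vec; _∷_; []; _∷ʳ_; reverse; tail; init; tabulate; lookup)
import Data.Vec.Properties as VecP
open import Data.Product using (Σ; _×_; _,_; proj₁; proj₂)
open import Data.Sum using (_⊎_)
open import Data.List using (List; []; _∷_)
open import Relation.Binary.PropositionalEquality using (_≡_; _≢_)
open import Relation.Nullary.Decidable using (⌊_⌋)
open import Function.Bundles using (_↔_; Inverse; _⇔_)

modr : (r : ℕ) {{_ : NonZero r}} → ℕ → Fin r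
modr r n = fromℕ< (m%n<n n r)

data Gen (r : ℕ) : Set where
  tau   : Fin r → Gen r
  rho   : Gen r
  sigma : Gen r

-- Throughout, s = suc t (so s ≥ 1) and Z_2 = Bool.
module _ (r t : ℕ) {{_ : NonZero r}} where

  Str : Set
  Str = Vec Bool (suc t)

  VC : Set
  VC = Fin r × Str

  suc1 : Fin r → Fin r
  suc1 x = modr r (suc (toℕ x))

  negr : ℕ → ℕ
  negr n = r ∸ (n % r)

  ArcC : VC → VC → Set
  ArcC (x , ε) (y , δ) =
    (y ≡ suc1 x) × Σ Bool λ a → Σ Bool λ b → Σ (Vec Bool t) λ h → (ε ≡ a ∷ h) × (δ ≡ h ∷ʳ b)

  AdjC : VC → VC → Set
  AdjC u v = ArcC u v ⊎ ArcC v u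

  τ : Fin r → VC → VC
  τ i (x , ε) = x , tabulate λ j →
    if ⌊ modr r (toℕ x + toℕ j) FinP.≟ i ⌋ then not (lookup ε j) else lookup ε j

  ρ : VC → VC
  ρ (x , ε) = suc1 x , ε

  σ : VC → VC
  σ (x , ε) = modr r (negr (toℕ x) + negr (suc t) + 1) , reverse ε

  gen : Gen r → VC → VC
  gen (tau i) = τ i
  gen rho     = ρ
  gen sigma   = σ

  -- A word g₁ g₂ ⋯ gₙ acts (on the right) as α ↦ α^{g₁ g₂ ⋯ gₙ}.
  -- H = { act w : w a word } (H is finite, so the generated monoid is the generated group).
  act : List (Gen r) → VC → VC
  act []      α = α
  act (g ∷ w) α = act w (gen g α)

  -- The 4-cycles of S, indexed by (x, h) ∈ Z_r × Z_2^{s-1}: the cycle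
  -- (x;0h) ~ (x+1;h0) ~ (x;1h) ~ (x+1;h1) ~ (x;0h), with vertex set
  -- {(x; a h) : a} ∪ {(x+1; h b) : b}.
  Cyc : Set
  Cyc = Fin r × Vec Bool t

  inCyc : VC → Cyc → Bool
  inCyc (y , ε) (x , h) =
    (⌊ y FinP.≟ x ⌋ ∧ ⌊ VecP.≡-dec BoolP._≟_ (tail ε) h ⌋)
    ∨ (⌊ y FinP.≟ suc1 x ⌋ ∧ ⌊ VecP.≡-dec BoolP._≟_ (init ε) h ⌋)

  VsC : Set
  VsC = Σ (VC × Cyc) λ p → T (inCyc (proj₁ p) (proj₂ p))

  vtx : VsC → VC
  vtx ((α , _) , _) = α

  cyc : VsC → Cyc
  cyc ((_ , C) , _) = C

  AdjsC : VsC → VsC → Set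
  AdjsC u v = ((cyc u ≢ cyc v) × (vtx u ≡ vtx v)) ⊎ ((cyc u ≡ cyc v) × AdjC (vtx u) (vtx v))

  IsAutsC : VsC ↔ VsC → Set
  IsAutsC φ = ∀ u v → AdjsC u v ⇔ AdjsC (Inverse.to φ u) (Inverse.to φ v)

  -- φ is the permutation of VsC induced by the permutation g of VC (with g preserving S):
  -- φ (α, C) = (α^g, C^g), where C^g is the cycle whose vertex set is the image of that of C.
  Induces : (VC → VC) → VsC ↔ VsC → Set
  Induces g φ = ∀ u →
    (vtx (Inverse.to φ u) ≡ g (vtx u)) ×
    (∀ γ → T (inCyc γ (cyc u)) ⇔ T (inCyc (g γ) (cyc (Inverse.to φ u))))

-- The generators of H permute the vertices of C(r, s) and the cycles of S compatibly (ρ and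
-- the τ_i keep the two sides of each 4-cycle, σ swaps them), so H acts on sC(r, s).
-- Conversely, every edge of sC(r, s) inside a copy of a 4-cycle of S lies on a 4-cycle, while
-- the edges joining the two copies of a vertex lie on none; so an automorphism preserves this
-- perfect matching and induces an automorphism f of C(r, s) preserving S. Three neighbours
-- of a vertex cannot all be heads or all tails of arcs, which forces f to raise every layer
-- by one along each arc or to lower every layer by one. After composing with σ and a power
-- of ρ, f fixes every layer, and the bit it flips in position j of a vertex in layer x only
-- depends on x + j; hence f is a product of τ_i's. For transitivity, σ chooses the side, ρ
-- the layer and the τ_i the string, the last step needing s ≤ r.
module Submission where

open import Defs
open import Data.Nat using (ℕ; zero; suc; _+_; _∸_; _*_; _≤_; _<_; NonZero; _%_; z≤n; s≤s; _<?_; >-nonZero⁻¹)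
open import Data.Nat.Properties
open import Data.Nat.DivMod using (m%n<n; m%n%n≡m%n; %-distribˡ-+; m<n⇒m%n≡m; [m+n]%n≡m%n; m*n%n≡0)
open import Data.Nat.Tactic.RingSolver using (solve-∀)
open import Data.Fin using (Fin; toℕ; inject₁; fromℕ) renaming (zero to fzero; suc to fsuc)
import Data.Fin.Properties as FinP
open import Data.Bool using (Bool; true; false; not; T; _∧_; _xor_; if_then_else_)
import Data.Bool.Properties as BoolP
open import Data.Vec using (Vec; _∷_; []; _∷ʳ_; reverse; head; last; tail; init; initLast; tabulate; lookup; replicate; zipWith)
import Data.Vec.Properties as VecP
open import Data.List as List using (List; []; _∷_; _++_)
open import Data.Product using (Σ; _×_; _,_; proj₁; proj₂)
open import Data.Sum using (_⊎_; inj₁; inj₂; [_,_]′; fromInj₁; fromInj₂)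
open import Data.Empty using (⊥; ⊥-elim)
open import Relation.Binary.Bundles using (Setoid)
import Relation.Binary.Reasoning.Setoid as SetoidReasoning
open import Relation.Binary.PropositionalEquality
open import Relation.Nullary using (yes; no; ¬_; Dec)
import Data.Product.Properties as ProdP
open import Relation.Nullary.Decidable using (⌊_⌋; toWitness)
open import Data.Unit using (tt)
open import Function.Bundles using (Equivalence; _↔_; Inverse; mk⇔; mk↔ₛ′)
open import Function.Base using (_∘_)

xor-cong-≢ : ∀ {a a' b b' : Bool} → a ≢ a' → b ≢ b' → a xor b ≡ a' xor b'
xor-cong-≢ {a} {b = b} a≢a' b≢b' with BoolP.¬-not (≢-sym a≢a') | BoolP.¬-not (≢-sym b≢b')
... | refl | refl = not-xor-not a b
  where
  not-xor-not : ∀ a b → a xor b ≡ not a xor not b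
  not-xor-not true  true  = refl
  not-xor-not true  false = refl
  not-xor-not false true  = refl
  not-xor-not false false = refl

xor-solveˡ : ∀ a b c → a xor b ≡ c → a ≡ b xor c
xor-solveˡ true  true  c refl = refl
xor-solveˡ true  false c refl = refl
xor-solveˡ false true  c refl = refl
xor-solveˡ false false c refl = refl

xor-cancelˡ : ∀ a b → a xor (a xor b) ≡ b
xor-cancelˡ true  b = BoolP.not-involutive b
xor-cancelˡ false b = refl

Bool-pigeonhole : ∀ (a b c : Bool) → a ≡ b ⊎ a ≡ c ⊎ b ≡ c
Bool-pigeonhole true  true  c     = inj₁ refl
Bool-pigeonhole false false c     = inj₁ refl
Bool-pigeonhole true  false true  = inj₂ (inj₁ refl)
Bool-pigeonhole true  false false = inj₂ (inj₂ refl)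
Bool-pigeonhole false true  true  = inj₂ (inj₂ refl)
Bool-pigeonhole false true  false = inj₂ (inj₁ refl)

module _ {A : Set} where

  shift : ∀ {n} → Vec A n → A → Vec A n
  shift []      b = []
  shift (a ∷ h) b = h ∷ʳ b

  ∷ʳ-head-shift : ∀ {n} (h : Vec A n) b → h ∷ʳ b ≡ head (h ∷ʳ b) ∷ shift h b
  ∷ʳ-head-shift []      b = refl
  ∷ʳ-head-shift (a ∷ h) b = refl

  init-∷ʳ-last : ∀ {n} (ε : Vec A (suc n)) → init ε ∷ʳ last ε ≡ ε
  init-∷ʳ-last ε = sym (proj₂ (proj₂ (initLast ε)))

  reverse-∷ʳ : ∀ {n} (h : Vec A n) b → reverse (h ∷ʳ b) ≡ b ∷ reverse h
  reverse-∷ʳ h b = VecP.reverse-injective (begin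
    reverse (reverse (h ∷ʳ b))  ≡⟨ VecP.reverse-involutive (h ∷ʳ b) ⟩
    h ∷ʳ b                      ≡⟨ cong (_∷ʳ b) (VecP.reverse-involutive h) ⟨
    reverse (reverse h) ∷ʳ b    ≡⟨ VecP.reverse-∷ b (reverse h) ⟨
    reverse (b ∷ reverse h)     ∎)
    where open ≡-Reasoning

  lookup-ext : ∀ {n} (v w : Vec A n) → (∀ i → lookup v i ≡ lookup w i) → v ≡ w
  lookup-ext v w eq = begin
    v                   ≡⟨ VecP.tabulate∘lookup v ⟨
    tabulate (lookup v) ≡⟨ VecP.tabulate-cong eq ⟩
    tabulate (lookup w) ≡⟨ VecP.tabulate∘lookup w ⟩
    w                   ∎
    where open ≡-Reasoning

flipWhere : ∀ {n} → (Fin n → Bool) → Vec Bool n → Vec Bool n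
flipWhere p v = tabulate λ j → if p j then not (lookup v j) else lookup v j

if-not≡xor : ∀ b a → (if b then not a else a) ≡ a xor b
if-not≡xor true  a = sym (trans (BoolP.xor-comm a true) (BoolP.true-xor a))
if-not≡xor false a = sym (BoolP.xor-identityʳ a)

flipWhere-involutive : ∀ {n} (p : Fin n → Bool) v → flipWhere p (flipWhere p v) ≡ v
flipWhere-involutive p v = lookup-ext _ v λ j → begin
  lookup (flipWhere p (flipWhere p v)) j              ≡⟨ VecP.lookup∘tabulate _ j ⟩
  flip (p j) (lookup (flipWhere p v) j)                ≡⟨ cong (flip (p j)) (VecP.lookup∘tabulate _ j) ⟩
  flip (p j) (flip (p j) (lookup v j))                 ≡⟨ flip-flip (p j) (lookup v j) ⟩
  lookup v j                                           ∎
  where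
  open ≡-Reasoning
  flip : Bool → Bool → Bool
  flip b a = if b then not a else a
  flip-flip : ∀ b a → flip b (flip b a) ≡ a
  flip-flip true  a = BoolP.not-involutive a
  flip-flip false a = refl

flipWhere-cong : ∀ {n} {p q : Fin n → Bool} → (∀ j → p j ≡ q j) → ∀ v → flipWhere p v ≡ flipWhere q v
flipWhere-cong p≗q v = VecP.tabulate-cong λ j → cong (λ c → if c then not (lookup v j) else lookup v j) (p≗q j)

flipWhere-∷ʳ : ∀ {n} (p : Fin (suc n) → Bool) (h : Vec Bool n) b →
  flipWhere p (h ∷ʳ b) ≡ flipWhere (p ∘ inject₁) h ∷ʳ (if p (fromℕ n) then not b else b)
flipWhere-∷ʳ p []      b = refl
flipWhere-∷ʳ p (a ∷ h) b = cong (_ ∷_) (flipWhere-∷ʳ (p ∘ fsuc) h b)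

-- Bit strings indexed by natural numbers, which keeps the index arithmetic of shifts
-- in ℕ; out-of-range bits read as false.
bitAt : ∀ {n} → Vec Bool n → ℕ → Bool
bitAt []      _       = false
bitAt (a ∷ v) zero    = a
bitAt (a ∷ v) (suc j) = bitAt v j

bitAt-lookup : ∀ {n} (v : Vec Bool n) (i : Fin n) → bitAt v (toℕ i) ≡ lookup v i
bitAt-lookup (a ∷ v) fzero    = refl
bitAt-lookup (a ∷ v) (fsuc i) = bitAt-lookup v i

bitAt-ext : ∀ {n} (v w : Vec Bool n) → (∀ j → j < n → bitAt v j ≡ bitAt w j) → v ≡ w
bitAt-ext []      []      eq = refl
bitAt-ext (a ∷ v) (b ∷ w) eq = cong₂ _∷_ (eq 0 (s≤s z≤n)) (bitAt-ext v w (λ j j<n → eq (suc j) (s≤s j<n)))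

bitAt-∷ʳ-< : ∀ {n} (v : Vec Bool n) b j → j < n → bitAt (v ∷ʳ b) j ≡ bitAt v j
bitAt-∷ʳ-< (a ∷ v) b zero    _         = refl
bitAt-∷ʳ-< (a ∷ v) b (suc j) (s≤s j<n) = bitAt-∷ʳ-< v b j j<n

bitAt-∷ʳ-last : ∀ {n} (v : Vec Bool n) b → bitAt (v ∷ʳ b) n ≡ b
bitAt-∷ʳ-last []      b = refl
bitAt-∷ʳ-last (a ∷ v) b = bitAt-∷ʳ-last v b

bitAt-shift-< : ∀ {n} (v : Vec Bool n) b j → suc j < n → bitAt (shift v b) j ≡ bitAt v (suc j)
bitAt-shift-< (a ∷ v) b j j<n = bitAt-∷ʳ-< v b j (≤-pred j<n)

bitAt-shift-last : ∀ {n} (v : Vec Bool (suc n)) b → bitAt (shift v b) n ≡ b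
bitAt-shift-last (a ∷ v) b = bitAt-∷ʳ-last v b

shiftIn : ∀ {n} → Vec Bool n → Vec Bool n → ℕ → Vec Bool n
shiftIn h z zero    = h
shiftIn h z (suc k) = shift (shiftIn h z k) (bitAt z k)

bitAt-shiftIn-old : ∀ {n} (h z : Vec Bool n) k j → j + k < n → bitAt (shiftIn h z k) j ≡ bitAt h (j + k)
bitAt-shiftIn-old h z zero    j _ = cong (bitAt h) (sym (+-identityʳ j))
bitAt-shiftIn-old {n} h z (suc k) j j+k<n = begin
  bitAt (shift (shiftIn h z k) (bitAt z k)) j ≡⟨ bitAt-shift-< (shiftIn h z k) _ j (≤-<-trans (s≤s (m≤m+n j k)) sj+k<n) ⟩
  bitAt (shiftIn h z k) (suc j)               ≡⟨ bitAt-shiftIn-old h z k (suc j) sj+k<n ⟩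
  bitAt h (suc j + k)                          ≡⟨ cong (bitAt h) (+-suc j k) ⟨
  bitAt h (j + suc k)                          ∎
  where
  open ≡-Reasoning
  sj+k<n : suc j + k < n
  sj+k<n = subst (_< n) (+-suc j k) j+k<n

bitAt-shiftIn-new : ∀ {n} (h z : Vec Bool n) k j → n ≤ j + k → j < n → bitAt (shiftIn h z k) j ≡ bitAt z (j + k ∸ n)
bitAt-shiftIn-new {n} h z zero    j n≤j j<n = ⊥-elim (<⇒≱ j<n (subst (n ≤_) (+-identityʳ j) n≤j))
bitAt-shiftIn-new {n} h z (suc k) j n≤j+sk j<n with suc j <? n
... | yes sj<n = begin
  bitAt (shift (shiftIn h z k) (bitAt z k)) j ≡⟨ bitAt-shift-< (shiftIn h z k) _ j sj<n ⟩
  bitAt (shiftIn h z k) (suc j)               ≡⟨ bitAt-shiftIn-new h z k (suc j) (subst (n ≤_) (+-suc j k) n≤j+sk) sj<n ⟩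
  bitAt z (suc j + k ∸ n)                      ≡⟨ cong (λ m → bitAt z (m ∸ n)) (+-suc j k) ⟨
  bitAt z (j + suc k ∸ n)                      ∎
  where open ≡-Reasoning
... | no sj≮n = trans (shift-last n h z k j j<n sj≡n) (cong (bitAt z) (sym j+sk∸n≡k))
  where
  sj≡n : suc j ≡ n
  sj≡n = ≤-antisym j<n (≮⇒≥ sj≮n)
  j+sk∸n≡k : j + suc k ∸ n ≡ k
  j+sk∸n≡k = trans (cong (_∸ n) (trans (+-suc j k) (cong (_+ k) sj≡n))) (m+n∸m≡n n k)
  shift-last : ∀ n (h z : Vec Bool n) k j → j < n → suc j ≡ n → bitAt (shift (shiftIn h z k) (bitAt z k)) j ≡ bitAt z k
  shift-last (suc n) h z k j _ refl = bitAt-shift-last (shiftIn h z k) (bitAt z k)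

shiftIn-all : ∀ {n} (h z : Vec Bool n) → shiftIn h z n ≡ z
shiftIn-all {n} h z = bitAt-ext _ _ λ j j<n →
  trans (bitAt-shiftIn-new h z n j (m≤n+m n j) j<n) (cong (bitAt z) (m+n∸n≡m j n))

parityAt : ∀ {n} → (Fin n → Bool) → Fin n → List (Fin n) → Bool
parityAt g p []      = false
parityAt g p (i ∷ L) = (g i ∧ ⌊ p FinP.≟ i ⌋) xor parityAt g p L

parityAt-fzero : ∀ {n k} (g : Fin (suc n) → Bool) (f : Fin k → Fin n) →
  parityAt g fzero (List.tabulate (fsuc ∘ f)) ≡ false
parityAt-fzero {k = zero}  g f = refl
parityAt-fzero {k = suc k} g f =
  trans (cong (_xor parityAt g fzero (List.tabulate (fsuc ∘ f ∘ fsuc))) (BoolP.∧-zeroʳ (g (fsuc (f fzero)))))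
        (parityAt-fzero g (f ∘ fsuc))

parityAt-fsuc : ∀ {n k} (g : Fin (suc n) → Bool) p (f : Fin k → Fin n) →
  parityAt g (fsuc p) (List.tabulate (fsuc ∘ f)) ≡ parityAt (g ∘ fsuc) p (List.tabulate f)
parityAt-fsuc {k = zero}  g p f = refl
parityAt-fsuc {k = suc k} g p f =
  cong₂ _xor_ (cong (g (fsuc (f fzero)) ∧_) (does-fsuc-≟ p (f fzero))) (parityAt-fsuc g p (f ∘ fsuc))
  where
  does-fsuc-≟ : ∀ {n} (p q : Fin n) → ⌊ fsuc p FinP.≟ fsuc q ⌋ ≡ ⌊ p FinP.≟ q ⌋
  does-fsuc-≟ p q with p FinP.≟ q
  ... | yes refl = refl
  ... | no  _    = refl

parityAt-allFin : ∀ {n} (g : Fin n → Bool) p → parityAt g p (List.allFin n) ≡ g p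
parityAt-allFin {suc n} g fzero = begin
  (g fzero ∧ true) xor parityAt g fzero (List.tabulate fsuc) ≡⟨ cong ((g fzero ∧ true) xor_) (parityAt-fzero g (λ i → i)) ⟩
  (g fzero ∧ true) xor false                                 ≡⟨ BoolP.xor-identityʳ _ ⟩
  g fzero ∧ true                                             ≡⟨ BoolP.∧-identityʳ _ ⟩
  g fzero                                                    ∎
  where open ≡-Reasoning
parityAt-allFin {suc n} g (fsuc p) = begin
  (g fzero ∧ false) xor parityAt g (fsuc p) (List.tabulate fsuc)
    ≡⟨ cong (_xor parityAt g (fsuc p) (List.tabulate fsuc)) (BoolP.∧-zeroʳ (g fzero)) ⟩
  parityAt g (fsuc p) (List.tabulate fsuc)                       ≡⟨ parityAt-fsuc g p (λ i → i) ⟩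
  parityAt (g ∘ fsuc) p (List.allFin n)                          ≡⟨ parityAt-allFin (g ∘ fsuc) p ⟩
  g (fsuc p)                                                     ∎
  where open ≡-Reasoning

+-rearrange : ∀ x y z → x + (y + z) ≡ (x + z) + y
+-rearrange = solve-∀

module Congruence (r : ℕ) {{_ : NonZero r}} where

  infix 4 _≈_
  _≈_ : ℕ → ℕ → Set
  a ≈ b = a % r ≡ b % r

  ≈-setoid : Setoid _ _
  ≈-setoid = record { _≈_ = _≈_ ; isEquivalence = record { refl = refl ; sym = sym ; trans = trans } }

  module ≈-Reasoning = SetoidReasoning ≈-setoid

  +-cong-≈ : ∀ {a b c d} → a ≈ b → c ≈ d → a + c ≈ b + d
  +-cong-≈ {a} {b} {c} {d} a≈b c≈d = begin
    (a + c) % r             ≡⟨ %-distribˡ-+ a c r ⟩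
    (a % r + c % r) % r     ≡⟨ cong₂ (λ x y → (x + y) % r) a≈b c≈d ⟩
    (b % r + d % r) % r     ≡⟨ %-distribˡ-+ b d r ⟨
    (b + d) % r             ∎
    where open ≡-Reasoning

  %-≈ : ∀ a → a % r ≈ a
  %-≈ a = m%n%n≡m%n a r

  +r≈ : ∀ a → a + r ≈ a
  +r≈ a = [m+n]%n≡m%n a r

  *r≈0 : ∀ a → a * r ≈ 0
  *r≈0 a = trans (m*n%n≡0 a r) (sym (m<n⇒m%n≡m (>-nonZero⁻¹ r)))

  neg : ℕ → ℕ
  neg a = r ∸ a % r

  neg-inverse : ∀ a → neg a + a ≈ 0
  neg-inverse a = begin
    neg a + a        ≈⟨ +-cong-≈ {neg a} refl (%-≈ a) ⟨
    neg a + a % r    ≡⟨ m∸n+n≡m (<⇒≤ (m%n<n a r)) ⟩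
    r                ≈⟨ +r≈ 0 ⟩
    0                ∎
    where open ≈-Reasoning

  +-cancelʳ-≈ : ∀ a b c → a + c ≈ b + c → a ≈ b
  +-cancelʳ-≈ a b c eq = begin
    a                  ≡⟨ +-identityʳ a ⟨
    a + 0              ≈⟨ +-cong-≈ {a} refl (neg-inverse c) ⟨
    a + (neg c + c)    ≡⟨ +-rearrange a (neg c) c ⟩
    (a + c) + neg c    ≈⟨ +-cong-≈ eq refl ⟩
    (b + c) + neg c    ≡⟨ +-rearrange b (neg c) c ⟨
    b + (neg c + c)    ≈⟨ +-cong-≈ {b} refl (neg-inverse c) ⟩
    b + 0              ≡⟨ +-identityʳ b ⟩
    b                  ∎
    where open ≈-Reasoning

  <r-≈⇒≡ : ∀ {a b} → a < r → b < r → a ≈ b → a ≡ b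
  <r-≈⇒≡ {a} {b} a<r b<r a≈b = trans (sym (m<n⇒m%n≡m a<r)) (trans a≈b (m<n⇒m%n≡m b<r))

  toℕ-modr-≈ : ∀ a → toℕ (modr r a) ≈ a
  toℕ-modr-≈ a = trans (cong (_% r) (FinP.toℕ-fromℕ< (m%n<n a r))) (%-≈ a)

  ≈⇒≡ᶠ : ∀ {x y : Fin r} → toℕ x ≈ toℕ y → x ≡ y
  ≈⇒≡ᶠ {x} {y} eq = FinP.toℕ-injective (<r-≈⇒≡ (FinP.toℕ<n x) (FinP.toℕ<n y) eq)

module PraegerXu (r t : ℕ) {{_ : NonZero r}} (r≥3 : 3 ≤ r) where

  open Congruence r

  next : Fin r → Fin r
  next = suc1 r t

  prev : Fin r → Fin r
  prev x = modr r (toℕ x + (r ∸ 1))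

  next-≈ : ∀ x → toℕ (next x) ≈ suc (toℕ x)
  next-≈ x = toℕ-modr-≈ (suc (toℕ x))

  1+[r∸1]≡r : suc (r ∸ 1) ≡ r
  1+[r∸1]≡r = suc-pred r

  next-prev : ∀ x → next (prev x) ≡ x
  next-prev x = ≈⇒≡ᶠ (begin
    toℕ (next (prev x))      ≈⟨ next-≈ (prev x) ⟩
    suc (toℕ (prev x))       ≈⟨ +-cong-≈ {1} refl (toℕ-modr-≈ _) ⟩
    suc (toℕ x + (r ∸ 1))    ≡⟨ +-suc (toℕ x) (r ∸ 1) ⟨
    toℕ x + suc (r ∸ 1)      ≡⟨ cong (toℕ x +_) 1+[r∸1]≡r ⟩
    toℕ x + r                ≈⟨ +r≈ (toℕ x) ⟩
    toℕ x                    ∎)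
    where open ≈-Reasoning

  prev-next : ∀ x → prev (next x) ≡ x
  prev-next x = ≈⇒≡ᶠ (begin
    toℕ (prev (next x))          ≈⟨ toℕ-modr-≈ _ ⟩
    toℕ (next x) + (r ∸ 1)       ≈⟨ +-cong-≈ (next-≈ x) refl ⟩
    suc (toℕ x) + (r ∸ 1)        ≡⟨ +-suc (toℕ x) (r ∸ 1) ⟨
    toℕ x + suc (r ∸ 1)          ≡⟨ cong (toℕ x +_) 1+[r∸1]≡r ⟩
    toℕ x + r                    ≈⟨ +r≈ (toℕ x) ⟩
    toℕ x                        ∎)
    where open ≈-Reasoning

  next-injective : ∀ {x y} → next x ≡ next y → x ≡ y
  next-injective {x} {y} eq = trans (sym (prev-next x)) (trans (cong prev eq) (prev-next y))

  next^ : ℕ → Fin r → Fin r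
  next^ zero    x = x
  next^ (suc k) x = next (next^ k x)

  next^-≈ : ∀ k x → toℕ (next^ k x) ≈ toℕ x + k
  next^-≈ zero    x = cong (_% r) (sym (+-identityʳ (toℕ x)))
  next^-≈ (suc k) x = begin
    toℕ (next (next^ k x))   ≈⟨ next-≈ (next^ k x) ⟩
    suc (toℕ (next^ k x))    ≈⟨ +-cong-≈ {1} refl (next^-≈ k x) ⟩
    suc (toℕ x + k)          ≡⟨ +-suc (toℕ x) k ⟨
    toℕ x + suc k            ∎
    where open ≈-Reasoning

  next^-cong : ∀ {k k'} x → k ≈ k' → next^ k x ≡ next^ k' x
  next^-cong {k} {k'} x k≈k' = ≈⇒≡ᶠ (begin
    toℕ (next^ k x)   ≈⟨ next^-≈ k x ⟩
    toℕ x + k         ≈⟨ +-cong-≈ {toℕ x} refl k≈k' ⟩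
    toℕ x + k'        ≈⟨ next^-≈ k' x ⟨
    toℕ (next^ k' x)  ∎)
    where open ≈-Reasoning

  next^-modr : ∀ k x → next^ k x ≡ modr r (toℕ x + k)
  next^-modr k x = ≈⇒≡ᶠ (trans (next^-≈ k x) (sym (toℕ-modr-≈ (toℕ x + k))))

  next^-+ : ∀ a b x → next^ a (next^ b x) ≡ next^ (a + b) x
  next^-+ zero    b x = refl
  next^-+ (suc a) b x = cong next (next^-+ a b x)

  next^-next : ∀ k x → next^ k (next x) ≡ next (next^ k x)
  next^-next zero    x = refl
  next^-next (suc k) x = cong next (next^-next k x)

  next^-reach : ∀ x y → next^ (toℕ y + (r ∸ toℕ x)) x ≡ y
  next^-reach x y = ≈⇒≡ᶠ (begin
    toℕ (next^ (toℕ y + (r ∸ toℕ x)) x)   ≈⟨ next^-≈ _ x ⟩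
    toℕ x + (toℕ y + (r ∸ toℕ x))         ≡⟨ +-rearrange (toℕ x) (toℕ y) (r ∸ toℕ x) ⟩
    toℕ x + (r ∸ toℕ x) + toℕ y           ≡⟨ cong (_+ toℕ y) (m+[n∸m]≡n (<⇒≤ (FinP.toℕ<n x))) ⟩
    r + toℕ y                             ≡⟨ +-comm r (toℕ y) ⟩
    toℕ y + r                             ≈⟨ +r≈ (toℕ y) ⟩
    toℕ y                                 ∎)
    where open ≈-Reasoning

  next^-back : ∀ n x → next^ n (next^ (n * (r ∸ 1)) x) ≡ x
  next^-back n x = begin
    next^ n (next^ (n * (r ∸ 1)) x)   ≡⟨ next^-+ n _ x ⟩
    next^ (n + n * (r ∸ 1)) x         ≡⟨ cong (λ k → next^ k x) n+n[r∸1]≡nr ⟩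
    next^ (n * r) x                   ≡⟨ next^-cong x (*r≈0 n) ⟩
    x                                 ∎
    where
    open ≡-Reasoning
    n+n[r∸1]≡nr : n + n * (r ∸ 1) ≡ n * r
    n+n[r∸1]≡nr = trans (sym (*-suc n (r ∸ 1))) (cong (n *_) 1+[r∸1]≡r)

  next^-comm : ∀ a b x → next^ a (next^ b x) ≡ next^ b (next^ a x)
  next^-comm a b x = trans (next^-+ a b x) (trans (cong (λ k → next^ k x) (+-comm a b)) (sym (next^-+ b a x)))

  x≢next^ : ∀ {k} x → 0 < k → k < r → x ≢ next^ k x
  x≢next^ {k} x 0<k k<r eq = <⇒≢ 0<k (<r-≈⇒≡ (>-nonZero⁻¹ r) k<r (+-cancelʳ-≈ 0 k (toℕ x) (begin
    0 + toℕ x          ≡⟨⟩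
    toℕ x              ≡⟨ cong toℕ eq ⟩
    toℕ (next^ k x)    ≈⟨ next^-≈ k x ⟩
    toℕ x + k          ≡⟨ +-comm (toℕ x) k ⟩
    k + toℕ x          ∎)))
    where open ≈-Reasoning

  x≢next : ∀ x → x ≢ next x
  x≢next x = x≢next^ x (s≤s z≤n) (≤-trans (s≤s (s≤s z≤n)) r≥3)

  x≢next² : ∀ x → x ≢ next (next x)
  x≢next² x = x≢next^ x (s≤s z≤n) r≥3

  adjacent-layers : ∀ y l m → l ≡ y ⊎ l ≡ next y → m ≡ y ⊎ m ≡ next y → m ≡ next l ⊎ l ≡ next m →
                    (l ≡ y × m ≡ next y) ⊎ (l ≡ next y × m ≡ y)
  adjacent-layers y .y        .y        (inj₁ refl) (inj₁ refl) (inj₁ eq) = ⊥-elim (x≢next y eq)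
  adjacent-layers y .y        .y        (inj₁ refl) (inj₁ refl) (inj₂ eq) = ⊥-elim (x≢next y eq)
  adjacent-layers y .y        .(next y) (inj₁ refl) (inj₂ refl) _         = inj₁ (refl , refl)
  adjacent-layers y .(next y) .y        (inj₂ refl) (inj₁ refl) _         = inj₂ (refl , refl)
  adjacent-layers y .(next y) .(next y) (inj₂ refl) (inj₂ refl) (inj₁ eq) = ⊥-elim (x≢next (next y) eq)
  adjacent-layers y .(next y) .(next y) (inj₂ refl) (inj₂ refl) (inj₂ eq) = ⊥-elim (x≢next (next y) eq)

  reflect : Fin r → Fin r
  reflect y = modr r (neg (toℕ y) + neg (suc t) + 1)

  reflect-sum : ∀ y → toℕ (reflect y) + toℕ y + suc t ≈ 1
  reflect-sum y = begin
    toℕ (reflect y) + toℕ y + suc t                ≈⟨ +-cong-≈ (+-cong-≈ (toℕ-modr-≈ _) refl) refl ⟩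
    neg (toℕ y) + neg (suc t) + 1 + toℕ y + suc t  ≡⟨ regroup (neg (toℕ y)) (neg (suc t)) (toℕ y) (suc t) ⟩
    (neg (toℕ y) + toℕ y) + (neg (suc t) + suc t) + 1
      ≈⟨ +-cong-≈ (+-cong-≈ (neg-inverse (toℕ y)) (neg-inverse (suc t))) refl ⟩
    1                                              ∎
    where
    open ≈-Reasoning
    regroup : ∀ a b c d → a + b + 1 + c + d ≡ (a + c) + (b + d) + 1
    regroup = solve-∀

  reflect-unique : ∀ y z → toℕ z + toℕ y + suc t ≈ 1 → z ≡ reflect y
  reflect-unique y z eq = ≈⇒≡ᶠ (+-cancelʳ-≈ (toℕ z) (toℕ (reflect y)) (toℕ y + suc t) (begin
    toℕ z + (toℕ y + suc t)               ≡⟨ +-assoc (toℕ z) _ _ ⟨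
    toℕ z + toℕ y + suc t                 ≈⟨ eq ⟩
    1                                     ≈⟨ reflect-sum y ⟨
    toℕ (reflect y) + toℕ y + suc t       ≡⟨ +-assoc (toℕ (reflect y)) _ _ ⟩
    toℕ (reflect y) + (toℕ y + suc t)     ∎))
    where open ≈-Reasoning

  reflect-involutive : ∀ y → reflect (reflect y) ≡ y
  reflect-involutive y = sym (reflect-unique (reflect y) y
    (trans (cong (λ a → (a + suc t) % r) (+-comm (toℕ y) (toℕ (reflect y)))) (reflect-sum y)))

  reflect-next : ∀ y → next (reflect (next y)) ≡ reflect y
  reflect-next y = reflect-unique y (next w) (begin
    toℕ (next w) + toℕ y + suc t     ≈⟨ +-cong-≈ (+-cong-≈ (next-≈ w) refl) refl ⟩
    suc (toℕ w) + toℕ y + suc t      ≡⟨ cong (_+ suc t) (sym (+-suc (toℕ w) (toℕ y))) ⟩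
    toℕ w + suc (toℕ y) + suc t      ≈⟨ +-cong-≈ (+-cong-≈ {toℕ w} refl (next-≈ y)) refl ⟨
    toℕ w + toℕ (next y) + suc t     ≈⟨ reflect-sum (next y) ⟩
    1                                ∎)
    where
    open ≈-Reasoning
    w : Fin r
    w = reflect (next y)

  -- The graph C(r, s) and the 4-cycles of S

  -- Walk from (x₀, h₀) to the layer x - n, then shift in the n bits of h.
  shift-induction : ∀ {n} (Q : Fin r → Vec Bool n → Set) → (∀ x h b → Q x h → Q (next x) (shift h b)) →
                    ∀ x₀ h₀ → Q x₀ h₀ → ∀ x h → Q x h
  shift-induction {n} Q closed x₀ h₀ q₀ x h =
    subst₂ Q arrive (shiftIn-all _ h) (iterate n _ _ h (iterate k x₀ h₀ h₀ q₀))
    where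
    iterate : ∀ k x h z → Q x h → Q (next^ k x) (shiftIn h z k)
    iterate zero    x h z q = q
    iterate (suc k) x h z q = closed _ _ _ (iterate k x h z q)
    k : ℕ
    k = toℕ (next^ (n * (r ∸ 1)) x) + (r ∸ toℕ x₀)
    arrive : next^ n (next^ k x₀) ≡ x
    arrive = trans (cong (next^ n) (next^-reach x₀ _)) (next^-back n x)

  Vertex : Set
  Vertex = VC r t

  Cycle : Set
  Cycle = Cyc r t

  SplitVertex : Set
  SplitVertex = VsC r t

  layer : Vertex → Fin r
  layer = proj₁

  left : Cycle → Bool → Vertex
  left (x , h) a = x , a ∷ h

  right : Cycle → Bool → Vertex
  right (x , h) b = next x , h ∷ʳ b

  side : Bool → Cycle → Bool → Vertex
  side true  = left
  side false = right

  infix 4 _∈ᶜ_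
  _∈ᶜ_ : Vertex → Cycle → Set
  α ∈ᶜ C = T (inCyc r t α C)

  ∈-left : ∀ C a → left C a ∈ᶜ C
  ∈-left (x , h) a with x FinP.≟ x | VecP.≡-dec BoolP._≟_ h h
  ... | yes _  | yes _  = tt
  ... | no x≢x | _      = ⊥-elim (x≢x refl)
  ... | yes _  | no h≢h = ⊥-elim (h≢h refl)

  ∈-right : ∀ C b → right C b ∈ᶜ C
  ∈-right (x , h) b with next x FinP.≟ x | next x FinP.≟ next x | VecP.≡-dec BoolP._≟_ (init (h ∷ʳ b)) h
  ... | yes eq | _      | _      = ⊥-elim (x≢next x (sym eq))
  ... | no _   | yes _  | yes _  = tt
  ... | no _   | no ≢   | _      = ⊥-elim (≢ refl)
  ... | no _   | yes _  | no ≢   = ⊥-elim (≢ (VecP.init-∷ʳ b h))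

  ∈-side : ∀ e C a → side e C a ∈ᶜ C
  ∈-side true  = ∈-left
  ∈-side false = ∈-right

  ∈-cases : ∀ α C → α ∈ᶜ C → (Σ Bool λ a → α ≡ left C a) ⊎ (Σ Bool λ b → α ≡ right C b)
  ∈-cases (y , ε) (x , h) α∈C with Equivalence.to BoolP.T-∨ α∈C
  ∈-cases (y , a ∷ h') (x , h) α∈C | inj₁ onLeft with Equivalence.to BoolP.T-∧ onLeft
  ... | y≟x , h'≟h with toWitness {a? = y FinP.≟ x} y≟x | toWitness {a? = VecP.≡-dec BoolP._≟_ h' h} h'≟h
  ... | refl | refl = inj₁ (a , refl)
  ∈-cases (y , ε) (x , h) α∈C | inj₂ onRight with Equivalence.to BoolP.T-∧ onRight
  ... | y≟x⁺ , init≟h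
    with toWitness {a? = y FinP.≟ next x} y≟x⁺ | toWitness {a? = VecP.≡-dec BoolP._≟_ (init ε) h} init≟h
  ... | refl | refl = inj₂ (last ε , cong (next x ,_) (sym (init-∷ʳ-last ε)))

  ∈-cases-side : ∀ α C → α ∈ᶜ C → Σ Bool λ e → Σ Bool λ a → α ≡ side e C a
  ∈-cases-side α C α∈C with ∈-cases α C α∈C
  ... | inj₁ (a , eq) = true , a , eq
  ... | inj₂ (b , eq) = false , b , eq

  left-injective : ∀ {C D a b} → left C a ≡ left D b → C ≡ D × a ≡ b
  left-injective {x , h} {y , g} refl = refl , refl

  right-injective : ∀ {C D a b} → right C a ≡ right D b → C ≡ D × a ≡ b
  right-injective {x , h} {y , g} eq with VecP.∷ʳ-injective h g (cong proj₂ eq)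
  ... | h≡g , a≡b = cong₂ _,_ (next-injective (cong proj₁ eq)) h≡g , a≡b

  side-injective : ∀ e {C D a b} → side e C a ≡ side e D b → C ≡ D × a ≡ b
  side-injective true  eq = left-injective eq
  side-injective false eq = right-injective eq

  layer-side : ∀ e C a b → layer (side e C a) ≡ layer (side e C b)
  layer-side true  C a b = refl
  layer-side false C a b = refl

  layer-∈ : ∀ α C → α ∈ᶜ C → layer α ≡ proj₁ C ⊎ layer α ≡ next (proj₁ C)
  layer-∈ α C α∈C with ∈-cases α C α∈C
  ... | inj₁ (a , refl) = inj₁ refl
  ... | inj₂ (b , refl) = inj₂ refl

  cycleˡ cycleʳ : Vertex → Cycle
  cycleˡ (x , ε) = x , tail ε
  cycleʳ (x , ε) = prev x , init ε

  ∈-cycleˡ : ∀ α → α ∈ᶜ cycleˡ α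
  ∈-cycleˡ (x , a ∷ h) = ∈-left (x , h) a

  right-cycleʳ : ∀ α → right (cycleʳ α) (last (proj₂ α)) ≡ α
  right-cycleʳ (x , ε) = cong₂ _,_ (next-prev x) (init-∷ʳ-last ε)

  ∈-cycleʳ : ∀ α → α ∈ᶜ cycleʳ α
  ∈-cycleʳ α = subst (_∈ᶜ cycleʳ α) (right-cycleʳ α) (∈-right (cycleʳ α) _)

  ∈⇒cycleˡ⊎cycleʳ : ∀ α C → α ∈ᶜ C → C ≡ cycleˡ α ⊎ C ≡ cycleʳ α
  ∈⇒cycleˡ⊎cycleʳ α (x , h) α∈C with ∈-cases α (x , h) α∈C
  ... | inj₁ (a , refl) = inj₁ refl
  ... | inj₂ (b , refl) = inj₂ (sym (cong₂ _,_ (prev-next x) (VecP.init-∷ʳ b h)))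

  cycleˡ≢cycleʳ : ∀ α → cycleˡ α ≢ cycleʳ α
  cycleˡ≢cycleʳ (x , ε) eq = x≢next x (sym (trans (cong (next ∘ proj₁) eq) (next-prev x)))

  step : Vertex → Bool → Vertex
  step (x , ε) b = next x , shift ε b

  arc⇒step : ∀ {α β} → ArcC r t α β → Σ Bool λ b → β ≡ step α b
  arc⇒step (refl , a , b , h , refl , refl) = b , refl

  arc-step : ∀ α b → ArcC r t α (step α b)
  arc-step (x , a ∷ h) b = refl , a , b , h , refl , refl

  adj-step : ∀ α b → AdjC r t α (step α b)
  adj-step α b = inj₁ (arc-step α b)

  adj-sym : ∀ {α β} → AdjC r t α β → AdjC r t β α
  adj-sym (inj₁ α→β) = inj₂ α→β
  adj-sym (inj₂ β→α) = inj₁ β→α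

  adj-sides : ∀ e C a b → AdjC r t (side e C a) (side (not e) C b)
  adj-sides true  (x , h) a b = inj₁ (refl , a , b , h , refl , refl)
  adj-sides false (x , h) a b = inj₂ (refl , b , a , h , refl , refl)

  adj⇒layer : ∀ {α β} → AdjC r t α β → layer β ≡ next (layer α) ⊎ layer α ≡ next (layer β)
  adj⇒layer (inj₁ α→β) with arc⇒step α→β
  ... | b , refl = inj₁ refl
  adj⇒layer (inj₂ β→α) with arc⇒step β→α
  ... | b , refl = inj₂ refl

  adj⇒layer≢ : ∀ {α β} → AdjC r t α β → layer α ≢ layer β
  adj⇒layer≢ {α} {β} adj eq with adj⇒layer adj
  ... | inj₁ up   = x≢next (layer α) (trans eq up)
  ... | inj₂ down = x≢next (layer β) (trans (sym eq) down)

  step-∈-cycleˡ : ∀ α b → step α b ∈ᶜ cycleˡ α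
  step-∈-cycleˡ (x , a ∷ h) b = ∈-right (x , h) b

  ∈-step⇒cycleˡ : ∀ α b C → α ∈ᶜ C → step α b ∈ᶜ C → C ≡ cycleˡ α
  ∈-step⇒cycleˡ α b C α∈C α⁺∈C with ∈⇒cycleˡ⊎cycleʳ α C α∈C
  ... | inj₁ eq   = eq
  ... | inj₂ refl with layer-∈ (step α b) (cycleʳ α) α⁺∈C
  ... | inj₁ eq = ⊥-elim (x≢next² (layer α) (sym (trans (cong next eq) (next-prev (layer α)))))
  ... | inj₂ eq = ⊥-elim (x≢next (layer α) (sym (trans (cong next (next-injective eq)) (next-prev (layer α)))))

  edge-cycle-unique : ∀ α β C D → AdjC r t α β → α ∈ᶜ C → β ∈ᶜ C → α ∈ᶜ D → β ∈ᶜ D → C ≡ D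
  edge-cycle-unique α β C D (inj₁ α→β) α∈C β∈C α∈D β∈D with arc⇒step α→β
  ... | b , refl = trans (∈-step⇒cycleˡ α b C α∈C β∈C) (sym (∈-step⇒cycleˡ α b D α∈D β∈D))
  edge-cycle-unique α β C D (inj₂ β→α) α∈C β∈C α∈D β∈D with arc⇒step β→α
  ... | b , refl = trans (∈-step⇒cycleˡ β b C β∈C α∈C) (sym (∈-step⇒cycleˡ β b D β∈D α∈D))

  arc-from-adj-up : ∀ α γ → AdjC r t α γ → layer γ ≡ next (layer α) → ArcC r t α γ
  arc-from-adj-up α γ (inj₁ α→γ) _ = α→γ
  arc-from-adj-up α γ (inj₂ γ→α) up with arc⇒step γ→α
  ... | b , refl = ⊥-elim (x≢next² (layer γ) up)

  arc-from-adj-down : ∀ γ α → AdjC r t γ α → next (layer γ) ≡ layer α → ArcC r t γ α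
  arc-from-adj-down γ α (inj₁ γ→α) _ = γ→α
  arc-from-adj-down γ α (inj₂ α→γ) down with arc⇒step α→γ
  ... | b , refl = ⊥-elim (x≢next² (layer α) (sym down))

  out-arc-injective : ∀ α γ γ' → ArcC r t α γ → ArcC r t α γ' → last (proj₂ γ) ≡ last (proj₂ γ') → γ ≡ γ'
  out-arc-injective (x , a ∷ h) γ γ' α→γ α→γ' eq with arc⇒step α→γ | arc⇒step α→γ'
  ... | b , refl | b' , refl =
    cong (λ c → next x , h ∷ʳ c) (trans (sym (VecP.last-∷ʳ b h)) (trans eq (VecP.last-∷ʳ b' h)))

  in-arc-injective : ∀ α γ γ' → ArcC r t γ α → ArcC r t γ' α → head (proj₂ γ) ≡ head (proj₂ γ') → γ ≡ γ'
  in-arc-injective α (x , a ∷ h) (x' , a' ∷ h') γ→α γ'→α eq with arc⇒step γ→α | arc⇒step γ'→α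
  ... | b , refl | b' , eq' =
    cong₂ _,_ (next-injective (cong proj₁ eq')) (cong₂ _∷_ eq (VecP.∷ʳ-injectiveˡ h h' (cong proj₂ eq')))

  at-most-two-out-arcs : ∀ α u₁ u₂ u₃ → ArcC r t α u₁ → ArcC r t α u₂ → ArcC r t α u₃ →
                         u₁ ≡ u₂ ⊎ u₁ ≡ u₃ ⊎ u₂ ≡ u₃
  at-most-two-out-arcs α u₁ u₂ u₃ a₁ a₂ a₃
    with Bool-pigeonhole (last (proj₂ u₁)) (last (proj₂ u₂)) (last (proj₂ u₃))
  ... | inj₁ eq        = inj₁ (out-arc-injective α u₁ u₂ a₁ a₂ eq)
  ... | inj₂ (inj₁ eq) = inj₂ (inj₁ (out-arc-injective α u₁ u₃ a₁ a₃ eq))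
  ... | inj₂ (inj₂ eq) = inj₂ (inj₂ (out-arc-injective α u₂ u₃ a₂ a₃ eq))

  at-most-two-in-arcs : ∀ α u₁ u₂ u₃ → ArcC r t u₁ α → ArcC r t u₂ α → ArcC r t u₃ α →
                        u₁ ≡ u₂ ⊎ u₁ ≡ u₃ ⊎ u₂ ≡ u₃
  at-most-two-in-arcs α u₁ u₂ u₃ a₁ a₂ a₃
    with Bool-pigeonhole (head (proj₂ u₁)) (head (proj₂ u₂)) (head (proj₂ u₃))
  ... | inj₁ eq        = inj₁ (in-arc-injective α u₁ u₂ a₁ a₂ eq)
  ... | inj₂ (inj₁ eq) = inj₂ (inj₁ (in-arc-injective α u₁ u₃ a₁ a₃ eq))
  ... | inj₂ (inj₂ eq) = inj₂ (inj₂ (in-arc-injective α u₂ u₃ a₂ a₃ eq))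

  vertex : SplitVertex → Vertex
  vertex = vtx r t

  cycle : SplitVertex → Cycle
  cycle = cyc r t

  splitVertex-≡ : ∀ {u v} → vertex u ≡ vertex v → cycle u ≡ cycle v → u ≡ v
  splitVertex-≡ {(α , C) , p} {(.α , .C) , q} refl refl = cong (_ ,_) (BoolP.T-irrelevant p q)

  -- The action of H

  record SideMap (f : Vertex → Vertex) (g : Cycle → Cycle) (flips : Bool) : Set where
    constructor sideMap
    field map-side : ∀ e C a → Σ Bool λ a' → f (side e C a) ≡ side (e xor flips) (g C) a'

  open SideMap

  module _ {f : Vertex → Vertex} {g : Cycle → Cycle} {flips : Bool} (sides : SideMap f g flips) where

    sideMap-∈ : ∀ α C → α ∈ᶜ C → f α ∈ᶜ g C
    sideMap-∈ α C α∈C with ∈-cases-side α C α∈C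
    ... | e , a , refl with map-side sides e C a
    ... | a' , eq = subst (_∈ᶜ g C) (sym eq) (∈-side (e xor flips) (g C) a')

    sideMap-arc : ∀ α β → ArcC r t α β → AdjC r t (f α) (f β)
    sideMap-arc (x , ε) (y , δ) (refl , a , b , h , refl , refl) with map-side sides true (x , h) a | map-side sides false (x , h) b
    ... | a' , eq₁ | b' , eq₂ = subst₂ (AdjC r t) (sym eq₁) (sym eq₂)
      (subst (λ e → AdjC r t (side (not flips) (g (x , h)) a') (side e (g (x , h)) b'))
             (BoolP.not-involutive flips) (adj-sides (not flips) (g (x , h)) a' b'))

    sideMap-adj : ∀ α β → AdjC r t α β → AdjC r t (f α) (f β)
    sideMap-adj α β (inj₁ α→β) = sideMap-arc α β α→β
    sideMap-adj α β (inj₂ β→α) = adj-sym (sideMap-arc β α β→α)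

  sideMap-∘ : ∀ {f f' g g' fl fl'} → SideMap f g fl → SideMap f' g' fl' → SideMap (f' ∘ f) (g' ∘ g) (fl xor fl')
  sideMap-∘ {f} {f'} {g} {g'} {fl} {fl'} sides sides' = sideMap compose
    where
    compose : ∀ e C a → Σ Bool λ a' → f' (f (side e C a)) ≡ side (e xor (fl xor fl')) (g' (g C)) a'
    compose e C a with map-side sides e C a
    ... | a₁ , eq₁ with map-side sides' (e xor fl) (g C) a₁
    ... | a₂ , eq₂ = a₂ , trans (cong f' eq₁) (trans eq₂ (cong (λ e' → side e' (g' (g C)) a₂) (BoolP.xor-assoc e fl fl')))

  record Symmetry : Set where
    field
      onV onV⁻¹ : Vertex → Vertex
      onC onC⁻¹ : Cycle → Cycle
      flips     : Bool
      onV⁻¹∘onV : ∀ α → onV⁻¹ (onV α) ≡ α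
      onV∘onV⁻¹ : ∀ α → onV (onV⁻¹ α) ≡ α
      onC⁻¹∘onC : ∀ C → onC⁻¹ (onC C) ≡ C
      onC∘onC⁻¹ : ∀ C → onC (onC⁻¹ C) ≡ C
      sides     : SideMap onV onC flips
      sides⁻¹   : SideMap onV⁻¹ onC⁻¹ flips

    onV-injective : ∀ {α β} → onV α ≡ onV β → α ≡ β
    onV-injective {α} {β} eq = trans (sym (onV⁻¹∘onV α)) (trans (cong onV⁻¹ eq) (onV⁻¹∘onV β))

    onC-injective : ∀ {C D} → onC C ≡ onC D → C ≡ D
    onC-injective {C} {D} eq = trans (sym (onC⁻¹∘onC C)) (trans (cong onC⁻¹ eq) (onC⁻¹∘onC D))

    ∈-onV⁻¹ : ∀ α C → onV α ∈ᶜ onC C → α ∈ᶜ C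
    ∈-onV⁻¹ α C α∈C = subst₂ _∈ᶜ_ (onV⁻¹∘onV α) (onC⁻¹∘onC C) (sideMap-∈ sides⁻¹ _ _ α∈C)

    adj-onV⁻¹ : ∀ α β → AdjC r t (onV α) (onV β) → AdjC r t α β
    adj-onV⁻¹ α β adj = subst₂ (AdjC r t) (onV⁻¹∘onV α) (onV⁻¹∘onV β) (sideMap-adj sides⁻¹ _ _ adj)

  open Symmetry

  identity : Symmetry
  identity = record
    { onV = λ α → α ; onV⁻¹ = λ α → α ; onC = λ C → C ; onC⁻¹ = λ C → C ; flips = false
    ; onV⁻¹∘onV = λ _ → refl ; onV∘onV⁻¹ = λ _ → refl ; onC⁻¹∘onC = λ _ → refl ; onC∘onC⁻¹ = λ _ → refl
    ; sides = unchanged ; sides⁻¹ = unchanged }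
    where
    unchanged : SideMap (λ α → α) (λ C → C) false
    unchanged = sideMap λ e C a → a , cong (λ e' → side e' C a) (sym (BoolP.xor-identityʳ e))

  infixr 9 _⨾_
  _⨾_ : Symmetry → Symmetry → Symmetry
  s ⨾ s' = record
    { onV = onV s' ∘ onV s ; onV⁻¹ = onV⁻¹ s ∘ onV⁻¹ s'
    ; onC = onC s' ∘ onC s ; onC⁻¹ = onC⁻¹ s ∘ onC⁻¹ s'
    ; flips = flips s xor flips s'
    ; onV⁻¹∘onV = λ α → trans (cong (onV⁻¹ s) (onV⁻¹∘onV s' (onV s α))) (onV⁻¹∘onV s α)
    ; onV∘onV⁻¹ = λ α → trans (cong (onV s') (onV∘onV⁻¹ s (onV⁻¹ s' α))) (onV∘onV⁻¹ s' α)
    ; onC⁻¹∘onC = λ C → trans (cong (onC⁻¹ s) (onC⁻¹∘onC s' (onC s C))) (onC⁻¹∘onC s C)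
    ; onC∘onC⁻¹ = λ C → trans (cong (onC s') (onC∘onC⁻¹ s (onC⁻¹ s' C))) (onC∘onC⁻¹ s' C)
    ; sides = sideMap-∘ (sides s) (sides s')
    ; sides⁻¹ = subst (SideMap _ _) (BoolP.xor-comm (flips s') (flips s)) (sideMap-∘ (sides⁻¹ s') (sides⁻¹ s)) }

  onC-from-side : ∀ s e C a e' D b → onV s (side e C a) ≡ side e' D b → e xor flips s ≡ e' → onC s C ≡ D
  onC-from-side s e C a e' D b eq refl with map-side (sides s) e C a
  ... | a' , eq' = proj₁ (side-injective (e xor flips s) (trans (sym eq') eq))

  module _ (s : Symmetry) where

    private
      lift : SplitVertex → SplitVertex
      lift ((α , C) , α∈C) = (onV s α , onC s C) , sideMap-∈ (sides s) α C α∈C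

      lift⁻¹ : SplitVertex → SplitVertex
      lift⁻¹ ((α , C) , α∈C) = (onV⁻¹ s α , onC⁻¹ s C) , sideMap-∈ (sides⁻¹ s) α C α∈C

    induced↔ : SplitVertex ↔ SplitVertex
    induced↔ = mk↔ₛ′ lift lift⁻¹
      (λ { ((α , C) , _) → splitVertex-≡ (onV∘onV⁻¹ s α) (onC∘onC⁻¹ s C) })
      (λ { ((α , C) , _) → splitVertex-≡ (onV⁻¹∘onV s α) (onC⁻¹∘onC s C) })

    private
      lift-adj : ∀ u v → AdjsC r t u v → AdjsC r t (lift u) (lift v)
      lift-adj ((α , C) , _) ((β , D) , _) (inj₁ (C≢D , α≡β)) =
        inj₁ ((λ eq → C≢D (onC-injective s eq)) , cong (onV s) α≡β)
      lift-adj ((α , C) , _) ((β , D) , _) (inj₂ (C≡D , adj)) =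
        inj₂ (cong (onC s) C≡D , sideMap-adj (sides s) α β adj)

      lift-adj⁻¹ : ∀ u v → AdjsC r t (lift u) (lift v) → AdjsC r t u v
      lift-adj⁻¹ ((α , C) , _) ((β , D) , _) (inj₁ (C≢D , α≡β)) =
        inj₁ ((λ eq → C≢D (cong (onC s) eq)) , onV-injective s α≡β)
      lift-adj⁻¹ ((α , C) , _) ((β , D) , _) (inj₂ (C≡D , adj)) =
        inj₂ (onC-injective s C≡D , adj-onV⁻¹ s α β adj)

    induced↔-isAut : IsAutsC r t induced↔
    induced↔-isAut u v = mk⇔ (lift-adj u v) (lift-adj⁻¹ u v)

    induced↔-induces : Induces r t (onV s) induced↔
    induced↔-induces ((α , C) , _) = refl , λ γ → mk⇔ (sideMap-∈ (sides s) γ C) (∈-onV⁻¹ s γ C)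

  ρ-symmetry : Symmetry
  ρ-symmetry = record
    { onV = ρ r t ; onV⁻¹ = λ (x , ε) → prev x , ε
    ; onC = λ (x , h) → next x , h ; onC⁻¹ = λ (x , h) → prev x , h
    ; flips = false
    ; onV⁻¹∘onV = λ (x , ε) → cong (_, ε) (prev-next x)
    ; onV∘onV⁻¹ = λ (x , ε) → cong (_, ε) (next-prev x)
    ; onC⁻¹∘onC = λ (x , h) → cong (_, h) (prev-next x)
    ; onC∘onC⁻¹ = λ (x , h) → cong (_, h) (next-prev x)
    ; sides = sideMap λ { true (x , h) a → a , refl ; false (x , h) b → b , refl }
    ; sides⁻¹ = sideMap λ { true (x , h) a → a , refl
                          ; false (x , h) b → b , cong (_, h ∷ʳ b) (trans (prev-next x) (sym (next-prev x))) } }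

  σ-symmetry : Symmetry
  σ-symmetry = record
    { onV = σ r t ; onV⁻¹ = σ r t ; onC = reflectᶜ ; onC⁻¹ = reflectᶜ ; flips = true
    ; onV⁻¹∘onV = σ-involutive ; onV∘onV⁻¹ = σ-involutive
    ; onC⁻¹∘onC = reflectᶜ-involutive ; onC∘onC⁻¹ = reflectᶜ-involutive
    ; sides = σ-sides ; sides⁻¹ = σ-sides }
    where
    reflectᶜ : Cycle → Cycle
    reflectᶜ (x , h) = reflect (next x) , reverse h

    σ-involutive : ∀ α → σ r t (σ r t α) ≡ α
    σ-involutive (x , ε) = cong₂ _,_ (reflect-involutive x) (VecP.reverse-involutive ε)

    reflectᶜ-involutive : ∀ C → reflectᶜ (reflectᶜ C) ≡ C
    reflectᶜ-involutive (x , h) = cong₂ _,_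
      (trans (cong reflect (reflect-next x)) (reflect-involutive x)) (VecP.reverse-involutive h)

    σ-sides : SideMap (σ r t) reflectᶜ true
    σ-sides = sideMap λ
      { true  (x , h) a → a , cong₂ _,_ (sym (reflect-next x)) (VecP.reverse-∷ a h)
      ; false (x , h) b → b , cong (reflect (next x) ,_) (reverse-∷ʳ h b) }

  τ-symmetry : Fin r → Symmetry
  τ-symmetry i = record
    { onV = τ r t i ; onV⁻¹ = τ r t i ; onC = τᶜ ; onC⁻¹ = τᶜ ; flips = false
    ; onV⁻¹∘onV = τ-involutive ; onV∘onV⁻¹ = τ-involutive
    ; onC⁻¹∘onC = τᶜ-involutive ; onC∘onC⁻¹ = τᶜ-involutive
    ; sides = τ-sides ; sides⁻¹ = τ-sides }
    where
    -- Bit j of the string of a vertex (x; ε) sits at position x + j, that of a cycle (x, h) at x + 1 + j.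
    flipsAt : Fin r → ℕ → ∀ {n} → Fin n → Bool
    flipsAt x k j = ⌊ modr r (toℕ x + (k + toℕ j)) FinP.≟ i ⌋

    τᶜ : Cycle → Cycle
    τᶜ (x , h) = x , flipWhere (flipsAt x 1) h

    τ-involutive : ∀ α → τ r t i (τ r t i α) ≡ α
    τ-involutive (x , ε) = cong (x ,_) (flipWhere-involutive (flipsAt x 0) ε)

    τᶜ-involutive : ∀ C → τᶜ (τᶜ C) ≡ C
    τᶜ-involutive (x , h) = cong (x ,_) (flipWhere-involutive (flipsAt x 1) h)

    flipsAt-next : ∀ x (j : Fin t) → flipsAt (next x) 0 (inject₁ j) ≡ flipsAt x 1 j
    flipsAt-next x j = cong (λ y → ⌊ y FinP.≟ i ⌋) (≈⇒≡ᶠ (begin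
      toℕ (modr r (toℕ (next x) + toℕ (inject₁ j)))   ≈⟨ toℕ-modr-≈ _ ⟩
      toℕ (next x) + toℕ (inject₁ j)                  ≈⟨ +-cong-≈ (next-≈ x) (cong (_% r) (FinP.toℕ-inject₁ j)) ⟩
      suc (toℕ x) + toℕ j                             ≡⟨ +-suc (toℕ x) (toℕ j) ⟨
      toℕ x + suc (toℕ j)                             ≈⟨ toℕ-modr-≈ _ ⟨
      toℕ (modr r (toℕ x + suc (toℕ j)))              ∎))
      where open ≈-Reasoning

    τ-sides : SideMap (τ r t i) τᶜ false
    τ-sides = sideMap λ
      { true  (x , h) a → _ , refl
      ; false (x , h) b → _ , cong (next x ,_)
          (trans (flipWhere-∷ʳ (flipsAt (next x) 0) h b)
                 (cong (_∷ʳ _) (flipWhere-cong (flipsAt-next x) h))) }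

  genSymmetry : Gen r → Symmetry
  genSymmetry (tau i) = τ-symmetry i
  genSymmetry rho     = ρ-symmetry
  genSymmetry sigma   = σ-symmetry

  wordSymmetry : List (Gen r) → Symmetry
  wordSymmetry []      = identity
  wordSymmetry (g ∷ w) = genSymmetry g ⨾ wordSymmetry w

  onV-genSymmetry : ∀ g α → onV (genSymmetry g) α ≡ gen r t g α
  onV-genSymmetry (tau i) α = refl
  onV-genSymmetry rho     α = refl
  onV-genSymmetry sigma   α = refl

  onV-wordSymmetry : ∀ w α → onV (wordSymmetry w) α ≡ act r t w α
  onV-wordSymmetry []      α = refl
  onV-wordSymmetry (g ∷ w) α =
    trans (onV-wordSymmetry w _) (cong (act r t w) (onV-genSymmetry g α))

  induces-cong : ∀ {g g' φ} → (∀ α → g α ≡ g' α) → Induces r t g φ → Induces r t g' φ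
  induces-cong {φ = φ} g≗g' induces u = trans (proj₁ (induces u)) (g≗g' _) , λ γ → mk⇔
    (λ γ∈C → subst (_∈ᶜ cycle (Inverse.to φ u)) (g≗g' γ) (Equivalence.to (proj₂ (induces u) γ) γ∈C))
    (λ γ∈C' → Equivalence.from (proj₂ (induces u) γ) (subst (_∈ᶜ cycle (Inverse.to φ u)) (sym (g≗g' γ)) γ∈C'))

  word-automorphism : ∀ w → Σ (SplitVertex ↔ SplitVertex) λ φ → IsAutsC r t φ × Induces r t (act r t w) φ
  word-automorphism w = induced↔ s , induced↔-isAut s ,
    induces-cong {g = onV s} {φ = induced↔ s} (onV-wordSymmetry w) (induced↔-induces s)
    where
    s : Symmetry
    s = wordSymmetry w

  act-++ : ∀ w v α → act r t (w ++ v) α ≡ act r t v (act r t w α)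
  act-++ []      v α = refl
  act-++ (g ∷ w) v α = act-++ w v (gen r t g α)

  act-ρ^ : ∀ m x ε → act r t (List.replicate m rho) (x , ε) ≡ (next^ m x , ε)
  act-ρ^ zero    x ε = refl
  act-ρ^ (suc m) x ε = trans (act-ρ^ m (next x) ε) (cong (_, ε) (next^-next m x))

  position : Fin r → Fin (suc t) → Fin r
  position x j = modr r (toℕ x + toℕ j)

  act-flips : ∀ c L x ε → act r t (List.map tau (List.filterᵇ c L)) (x , ε)
                        ≡ (x , tabulate λ j → lookup ε j xor parityAt c (position x j) L)
  act-flips c [] x ε = cong (x ,_) (lookup-ext _ _ λ j →
    trans (sym (BoolP.xor-identityʳ (lookup ε j))) (sym (VecP.lookup∘tabulate (λ k → lookup ε k xor false) j)))
  act-flips c (i ∷ L) x ε with c i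
  ... | false = act-flips c L x ε
  ... | true  = trans (act-flips c L x _) (cong (x ,_) (VecP.tabulate-cong λ j → begin
    lookup (flipWhere flipsAt ε) j xor parity j
      ≡⟨ cong (_xor parity j) (VecP.lookup∘tabulate (λ k → if flipsAt k then not (lookup ε k) else lookup ε k) j) ⟩
    (if flipsAt j then not (lookup ε j) else lookup ε j) xor parity j
      ≡⟨ cong (_xor parity j) (if-not≡xor (flipsAt j) (lookup ε j)) ⟩
    (lookup ε j xor flipsAt j) xor parity j                        ≡⟨ BoolP.xor-assoc (lookup ε j) (flipsAt j) (parity j) ⟩
    lookup ε j xor (flipsAt j xor parity j)                        ∎))
    where
    open ≡-Reasoning
    flipsAt : Fin (suc t) → Bool
    flipsAt j = ⌊ position x j FinP.≟ i ⌋
    parity : Fin (suc t) → Bool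
    parity j = parityAt c (position x j) L

  flipWord : (Fin r → Bool) → List (Gen r)
  flipWord c = List.map tau (List.filterᵇ c (List.allFin r))

  act-flipWord : ∀ c x ε → act r t (flipWord c) (x , ε) ≡ (x , tabulate λ j → lookup ε j xor c (position x j))
  act-flipWord c x ε = trans (act-flips c (List.allFin r) x ε)
    (cong (x ,_) (VecP.tabulate-cong λ j → cong (lookup ε j xor_) (parityAt-allFin c (position x j))))

  -- Automorphisms of C(r, s) preserving S lie in H

  record PreservesS (f : Vertex → Vertex) : Set where
    field
      injective : ∀ {α β} → f α ≡ f β → α ≡ β
      adjacent  : ∀ α β → AdjC r t α β → AdjC r t (f α) (f β)
      image     : Cycle → Cycle
      ∈-image   : ∀ γ C → γ ∈ᶜ C → f γ ∈ᶜ image C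

  Ascending Descending : (Vertex → Vertex) → Set
  Ascending  f = ∀ α b → layer (f (step α b)) ≡ next (layer (f α))
  Descending f = ∀ α b → next (layer (f (step α b))) ≡ layer (f α)

  module Orientation {f : Vertex → Vertex} (P : PreservesS f) where
    open PreservesS P

    Distinct₃ : Vertex → Vertex → Vertex → Set
    Distinct₃ u₁ u₂ u₃ = u₁ ≢ u₂ × u₁ ≢ u₃ × u₂ ≢ u₃

    images-distinct : ∀ {u₁ u₂ u₃} → Distinct₃ u₁ u₂ u₃ →
                      f u₁ ≡ f u₂ ⊎ f u₁ ≡ f u₃ ⊎ f u₂ ≡ f u₃ → ⊥
    images-distinct (d₁₂ , d₁₃ , d₂₃) (inj₁ eq)        = d₁₂ (injective eq)
    images-distinct (d₁₂ , d₁₃ , d₂₃) (inj₂ (inj₁ eq)) = d₁₃ (injective eq)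
    images-distinct (d₁₂ , d₁₃ , d₂₃) (inj₂ (inj₂ eq)) = d₂₃ (injective eq)

    Above Below : Vertex → Vertex → Set
    Above α u = AdjC r t α u × layer (f u) ≡ next (layer (f α))
    Below α u = AdjC r t α u × next (layer (f u)) ≡ layer (f α)

    no-three-above : ∀ α u₁ u₂ u₃ → Distinct₃ u₁ u₂ u₃ → Above α u₁ → Above α u₂ → Above α u₃ → ⊥
    no-three-above α u₁ u₂ u₃ d (adj₁ , up₁) (adj₂ , up₂) (adj₃ , up₃) = images-distinct d
      (at-most-two-out-arcs (f α) (f u₁) (f u₂) (f u₃)
        (arc-from-adj-up _ _ (adjacent α u₁ adj₁) up₁)
        (arc-from-adj-up _ _ (adjacent α u₂ adj₂) up₂)
        (arc-from-adj-up _ _ (adjacent α u₃ adj₃) up₃))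

    no-three-below : ∀ α u₁ u₂ u₃ → Distinct₃ u₁ u₂ u₃ → Below α u₁ → Below α u₂ → Below α u₃ → ⊥
    no-three-below α u₁ u₂ u₃ d (adj₁ , down₁) (adj₂ , down₂) (adj₃ , down₃) = images-distinct d
      (at-most-two-in-arcs (f α) (f u₁) (f u₂) (f u₃)
        (arc-from-adj-down _ _ (adj-sym (adjacent α u₁ adj₁)) down₁)
        (arc-from-adj-down _ _ (adj-sym (adjacent α u₂ adj₂)) down₂)
        (arc-from-adj-down _ _ (adj-sym (adjacent α u₃ adj₃)) down₃))

    AscendingOn DescendingOn : Cycle → Set
    AscendingOn  C = ∀ a b → layer (f (right C b)) ≡ next (layer (f (left C a)))
    DescendingOn C = ∀ a b → next (layer (f (right C b))) ≡ layer (f (left C a))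

    module Placement (C : Cycle) where
      y : Fin r
      y = proj₁ (image C)

      Up Down : Bool → Bool → Set
      Up   a b = layer (f (left C a)) ≡ y      × layer (f (right C b)) ≡ next y
      Down a b = layer (f (left C a)) ≡ next y × layer (f (right C b)) ≡ y

      placement : ∀ a b → Up a b ⊎ Down a b
      placement a b = adjacent-layers y _ _
        (layer-∈ _ _ (∈-image _ C (∈-left C a)))
        (layer-∈ _ _ (∈-image _ C (∈-right C b)))
        (adj⇒layer (adjacent _ _ (adj-sides true C a b)))

      not-mixed : ∀ {a b a' b'} → Up a b → Down a' b' → ⊥
      not-mixed {a} {b' = b'} (left-y , _) (_ , right'-y) with placement a b'
      ... | inj₁ (_ , right'-y⁺) = x≢next y (trans (sym right'-y) right'-y⁺)
      ... | inj₂ (left-y⁺ , _)   = x≢next y (trans (sym left-y) left-y⁺)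

    ascendingOn⊎descendingOn : ∀ C → AscendingOn C ⊎ DescendingOn C
    ascendingOn⊎descendingOn C = decide (placement false false)
      where
      open Placement C
      ascend : Up false false → ∀ a b → Up a b ⊎ Down a b → layer (f (right C b)) ≡ next (layer (f (left C a)))
      ascend _   a b (inj₁ (left-y , right-y⁺)) = trans right-y⁺ (cong next (sym left-y))
      ascend up₀ a b (inj₂ down)                = ⊥-elim (not-mixed up₀ down)
      descend : Down false false → ∀ a b → Up a b ⊎ Down a b → next (layer (f (right C b))) ≡ layer (f (left C a))
      descend down₀ a b (inj₁ up)                 = ⊥-elim (not-mixed up down₀)
      descend _     a b (inj₂ (left-y⁺ , right-y)) = trans (cong next right-y) (sym left-y⁺)
      decide : Up false false ⊎ Down false false → AscendingOn C ⊎ DescendingOn C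
      decide (inj₁ up₀)   = inj₁ λ a b → ascend up₀ a b (placement a b)
      decide (inj₂ down₀) = inj₂ λ a b → descend down₀ a b (placement a b)

    -- right C b = left C' c is where C and C' = (x + 1, shift h b) meet: its neighbour
    -- left C false and the two vertices right C' _ cannot all map to one side of its image.
    module Junction (x : Fin r) (h : Vec Bool t) (b : Bool) where
      C C' : Cycle
      C  = x , h
      C' = next x , shift h b

      c : Bool
      c = head (h ∷ʳ b)

      right≡left : right C b ≡ left C' c
      right≡left = cong (next x ,_) (∷ʳ-head-shift h b)

      distinct : Distinct₃ (left C false) (right C' false) (right C' true)
      distinct = (λ eq → x≢next² x (cong layer eq)) , (λ eq → x≢next² x (cong layer eq))
               , (λ eq → BoolP.not-¬ refl (proj₂ (right-injective eq)))

      adj-left : AdjC r t (right C b) (left C false)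
      adj-left = adj-sym (adj-sides true C false b)

      adj-right : ∀ b' → AdjC r t (right C b) (right C' b')
      adj-right b' = subst (λ α → AdjC r t α (right C' b')) (sym right≡left) (adj-sides true C' c b')

      layer-right≡layer-left : layer (f (left C' c)) ≡ layer (f (right C b))
      layer-right≡layer-left = cong (layer ∘ f) (sym right≡left)

    ascending-then-descending : ∀ x h b → AscendingOn (x , h) → DescendingOn (next x , shift h b) → ⊥
    ascending-then-descending x h b asc desc = no-three-below (right C b) _ _ _ distinct
      (adj-left      , sym (asc false b))
      (adj-right false , trans (desc c false) layer-right≡layer-left)
      (adj-right true  , trans (desc c true)  layer-right≡layer-left)
      where open Junction x h b

    descending-then-ascending : ∀ x h b → DescendingOn (x , h) → AscendingOn (next x , shift h b) → ⊥
    descending-then-ascending x h b desc asc = no-three-above (right C b) _ _ _ distinct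
      (adj-left      , sym (desc false b))
      (adj-right false , trans (asc c false) (cong next layer-right≡layer-left))
      (adj-right true  , trans (asc c true)  (cong next layer-right≡layer-left))
      where open Junction x h b

    ascending⊎descending : Ascending f ⊎ Descending f
    ascending⊎descending = orient (ascendingOn⊎descendingOn base)
      where
      base : Cycle
      base = modr r 0 , replicate t false

      ascendingOn-shift : ∀ x h b → AscendingOn (x , h) → AscendingOn (next x , shift h b)
      ascendingOn-shift x h b asc =
        fromInj₁ (⊥-elim ∘ ascending-then-descending x h b asc) (ascendingOn⊎descendingOn _)

      descendingOn-shift : ∀ x h b → DescendingOn (x , h) → DescendingOn (next x , shift h b)
      descendingOn-shift x h b desc =
        fromInj₂ (⊥-elim ∘ descending-then-ascending x h b desc) (ascendingOn⊎descendingOn _)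

      orient : AscendingOn base ⊎ DescendingOn base → Ascending f ⊎ Descending f
      orient (inj₁ asc) = inj₁ λ { (x , a ∷ h) b →
        shift-induction (λ x h → AscendingOn (x , h)) ascendingOn-shift _ _ asc x h a b }
      orient (inj₂ desc) = inj₂ λ { (x , a ∷ h) b →
        shift-induction (λ x h → DescendingOn (x , h)) descendingOn-shift _ _ desc x h a b }

  module Decode {f : Vertex → Vertex} (P : PreservesS f) (asc : Ascending f) (layer-fixed : ∀ α → layer (f α) ≡ layer α) where
    open PreservesS P

    F : Fin r → Str r t → Str r t
    F x ε = proj₂ (f (x , ε))

    f≡ : ∀ x ε → f (x , ε) ≡ (x , F x ε)
    f≡ x ε = cong (_, F x ε) (layer-fixed (x , ε))

    F-injective : ∀ x {ε δ} → F x ε ≡ F x δ → ε ≡ δ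
    F-injective x eq = cong proj₂ (injective (trans (f≡ x _) (trans (cong (x ,_) eq) (sym (f≡ x _)))))

    F-shift : ∀ x ε b → Σ Bool λ c → F (next x) (shift ε b) ≡ shift (F x ε) c
    F-shift x ε b with arc⇒step (arc-from-adj-up _ _ (adjacent _ _ (adj-step (x , ε) b)) (asc (x , ε) b))
    ... | c , eq = c , cong proj₂ eq

    defect : Fin r → ℕ → Str r t → Bool
    defect x j ε = bitAt (F x ε) j xor bitAt ε j

    defect-shift : ∀ x j ε b → suc j < suc t → defect x (suc j) ε ≡ defect (next x) j (shift ε b)
    defect-shift x j ε b j<t with F-shift x ε b
    ... | c , eq = sym (cong₂ _xor_
      (trans (cong (λ v → bitAt v j) eq) (bitAt-shift-< (F x ε) c j j<t))
      (bitAt-shift-< ε b j j<t))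

    defect-transport : ∀ k j x ε z → j + k ≤ t → defect x (j + k) ε ≡ defect (next^ k x) j (shiftIn ε z k)
    defect-transport zero    j x ε z _ = cong (λ m → defect x m ε) (+-identityʳ j)
    defect-transport (suc k) j x ε z j+k<t = begin
      defect x (j + suc k) ε                               ≡⟨ cong (λ m → defect x m ε) (+-suc j k) ⟩
      defect x (suc j + k) ε                               ≡⟨ defect-transport k (suc j) x ε z sj+k≤t ⟩
      defect (next^ k x) (suc j) (shiftIn ε z k)           ≡⟨ defect-shift _ j _ (bitAt z k) sj<s ⟩
      defect (next^ (suc k) x) j (shiftIn ε z (suc k))     ∎
      where
      open ≡-Reasoning
      sj+k≤t : suc j + k ≤ t
      sj+k≤t = subst (_≤ t) (+-suc j k) j+k<t
      sj<s : suc j < suc t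
      sj<s = s≤s (≤-trans (m≤m+n (suc j) k) sj+k≤t)

    defect-last : ∀ x ε b c → F (next x) (shift ε b) ≡ shift (F x ε) c → defect (next x) t (shift ε b) ≡ c xor b
    defect-last x ε b c eq = cong₂ _xor_
      (trans (cong (λ v → bitAt v t) eq) (bitAt-shift-last (F x ε) c)) (bitAt-shift-last ε b)

    defect-last-independent : ∀ x ε b b' → defect (next x) t (shift ε b) ≡ defect (next x) t (shift ε b')
    defect-last-independent x ε b b' with b BoolP.≟ b' | F-shift x ε b | F-shift x ε b'
    ... | yes refl | _ | _ = refl
    ... | no b≢b' | c , eq | c' , eq' =
      trans (defect-last x ε b c eq) (trans (xor-cong-≢ c≢c' b≢b') (sym (defect-last x ε b' c' eq')))
      where
      c≢c' : c ≢ c'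
      c≢c' refl = b≢b' (begin
        b                          ≡⟨ bitAt-shift-last ε b ⟨
        bitAt (shift ε b) t        ≡⟨ cong (λ v → bitAt v t) (F-injective (next x) (trans eq (sym eq'))) ⟩
        bitAt (shift ε b') t       ≡⟨ bitAt-shift-last ε b' ⟩
        b'                         ∎)
        where open ≡-Reasoning

    zeros : Str r t
    zeros = replicate (suc t) false

    -- Transported t layers back, bit 0 becomes the last bit, which is the freshly shifted-in one.
    defect₀-constant : ∀ y δ → defect y 0 δ ≡ defect y 0 zeros
    defect₀-constant y δ = begin
      defect y 0 δ                               ≡⟨ via-last δ ⟩
      defect x t (shift zeros (bitAt δ 0))       ≡⟨ fresh-bit-irrelevant (bitAt δ 0) ⟩
      defect x t (shift zeros false)             ≡⟨ via-last zeros ⟨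
      defect y 0 zeros                           ∎
      where
      open ≡-Reasoning
      x : Fin r
      x = next^ (t * (r ∸ 1)) y

      fresh-bit-irrelevant : ∀ b → defect x t (shift zeros b) ≡ defect x t (shift zeros false)
      fresh-bit-irrelevant b = subst (λ z → defect z t (shift zeros b) ≡ defect z t (shift zeros false))
        (next-prev x) (defect-last-independent (prev x) zeros b false)

      refill : ∀ δ → shiftIn (shift zeros (bitAt δ 0)) (shift δ false) t ≡ δ
      refill δ = bitAt-ext _ _ bit
        where
        bit : ∀ j → j < suc t → bitAt (shiftIn (shift zeros (bitAt δ 0)) (shift δ false) t) j ≡ bitAt δ j
        bit zero    _ = trans (bitAt-shiftIn-old _ _ t 0 ≤-refl) (bitAt-shift-last zeros (bitAt δ 0))
        bit (suc j) (s≤s j≤t) = begin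
          bitAt (shiftIn _ (shift δ false) t) (suc j) ≡⟨ bitAt-shiftIn-new _ _ t (suc j) (s≤s (m≤n+m t j)) (s≤s j≤t) ⟩
          bitAt (shift δ false) (j + t ∸ t)           ≡⟨ cong (bitAt (shift δ false)) (m+n∸n≡m j t) ⟩
          bitAt (shift δ false) j                     ≡⟨ bitAt-shift-< δ false j (s≤s j≤t) ⟩
          bitAt δ (suc j)                             ∎

      via-last : ∀ δ → defect y 0 δ ≡ defect x t (shift zeros (bitAt δ 0))
      via-last δ = sym (trans (defect-transport t 0 x (shift zeros (bitAt δ 0)) (shift δ false) ≤-refl)
                              (cong₂ (λ u v → defect u 0 v) (next^-back t y) (refill δ)))

    selector : Fin r → Bool
    selector y = defect y 0 zeros

    bitAt-F : ∀ x ε j → j < suc t → bitAt (F x ε) j ≡ bitAt ε j xor selector (next^ j x)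
    bitAt-F x ε j j<s = xor-solveˡ _ _ _ (trans (defect-transport j 0 x ε zeros (≤-pred j<s))
                                               (defect₀-constant (next^ j x) _))

    f≡flipWord : ∀ α → f α ≡ act r t (flipWord selector) α
    f≡flipWord (x , ε) = trans (f≡ x ε) (trans (cong (x ,_) (lookup-ext _ _ bit)) (sym (act-flipWord selector x ε)))
      where
      bit : ∀ j → lookup (F x ε) j ≡ lookup (tabulate λ j → lookup ε j xor selector (position x j)) j
      bit j = begin
        lookup (F x ε) j                             ≡⟨ bitAt-lookup (F x ε) j ⟨
        bitAt (F x ε) (toℕ j)                        ≡⟨ bitAt-F x ε (toℕ j) (FinP.toℕ<n j) ⟩
        bitAt ε (toℕ j) xor selector (next^ (toℕ j) x)
          ≡⟨ cong₂ _xor_ (bitAt-lookup ε j) (cong selector (next^-modr (toℕ j) x)) ⟩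
        lookup ε j xor selector (position x j)
          ≡⟨ VecP.lookup∘tabulate (λ j → lookup ε j xor selector (position x j)) j ⟨
        lookup (tabulate λ j → lookup ε j xor selector (position x j)) j ∎
        where open ≡-Reasoning

  preservesS-act : ∀ {f} → PreservesS f → ∀ w → PreservesS (act r t w ∘ f)
  preservesS-act {f} P w = record
    { injective = λ eq → injective (onV-injective s (trans (onV≡ _) (trans eq (sym (onV≡ _)))))
    ; adjacent  = λ α β adj → subst₂ (AdjC r t) (onV≡ _) (onV≡ _) (sideMap-adj (sides s) _ _ (adjacent α β adj))
    ; image     = onC s ∘ image
    ; ∈-image   = λ γ C γ∈C → subst (_∈ᶜ onC s (image C)) (onV≡ _) (sideMap-∈ (sides s) _ _ (∈-image γ C γ∈C)) }
    where
    open PreservesS P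
    s : Symmetry
    s = wordSymmetry w
    onV≡ : ∀ α → onV s α ≡ act r t w α
    onV≡ = onV-wordSymmetry w

  -- Rotate by ρ^m so that some vertex keeps its layer; orientation then forces every vertex to.
  ascending⇒word : ∀ {f} → PreservesS f → Ascending f → Σ (List (Gen r)) λ w → ∀ α → f α ≡ act r t w α
  ascending⇒word {f} P asc = w ++ unrotate , λ α → begin
    f α                            ≡⟨ undo α ⟨
    act r t unrotate (g α)         ≡⟨ cong (act r t unrotate) (Decode.f≡flipWord Pg asc-g layer-fixed α) ⟩
    act r t unrotate (act r t w α) ≡⟨ act-++ w unrotate α ⟨
    act r t (w ++ unrotate) α      ∎
    where
    open ≡-Reasoning
    α₀ : Vertex
    α₀ = modr r 0 , replicate (suc t) false
    m : ℕ
    m = toℕ (layer α₀) + (r ∸ toℕ (layer (f α₀)))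
    g : Vertex → Vertex
    g = act r t (List.replicate m rho) ∘ f
    Pg : PreservesS g
    Pg = preservesS-act P (List.replicate m rho)
    layer-g : ∀ α → layer (g α) ≡ next^ m (layer (f α))
    layer-g α = cong layer (act-ρ^ m (layer (f α)) (proj₂ (f α)))
    asc-g : Ascending g
    asc-g α b = trans (layer-g _) (trans (cong (next^ m) (asc α b)) (trans (next^-next m _) (cong next (sym (layer-g α)))))
    layer-fixed : ∀ α → layer (g α) ≡ layer α
    layer-fixed (x , ε) = shift-induction (λ x ε → layer (g (x , ε)) ≡ x)
      (λ x ε b eq → trans (asc-g (x , ε) b) (cong next eq))
      (layer α₀) (proj₂ α₀) (trans (layer-g α₀) (next^-reach (layer (f α₀)) (layer α₀))) x ε
    w : List (Gen r)
    w = flipWord (Decode.selector Pg asc-g layer-fixed)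
    unrotate : List (Gen r)
    unrotate = List.replicate (m * (r ∸ 1)) rho
    undo : ∀ α → act r t unrotate (g α) ≡ f α
    undo α = begin
      act r t unrotate (g α)
        ≡⟨ cong (act r t unrotate) (act-ρ^ m (layer (f α)) (proj₂ (f α))) ⟩
      act r t unrotate (next^ m (layer (f α)) , proj₂ (f α))    ≡⟨ act-ρ^ (m * (r ∸ 1)) _ _ ⟩
      next^ (m * (r ∸ 1)) (next^ m (layer (f α))) , proj₂ (f α)
        ≡⟨ cong (_, proj₂ (f α)) (trans (next^-comm (m * (r ∸ 1)) m _) (next^-back m _)) ⟩
      f α                                                       ∎

  descending⇒word : ∀ {f} → PreservesS f → Descending f → Σ (List (Gen r)) λ w → ∀ α → f α ≡ act r t w α
  descending⇒word {f} P desc = w ++ sigma ∷ [] , λ α → begin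
    f α                          ≡⟨ Symmetry.onV⁻¹∘onV σ-symmetry (f α) ⟨
    σ r t (σ r t (f α))          ≡⟨ cong (σ r t) (σ∘f≡ α) ⟩
    σ r t (act r t w α)          ≡⟨ act-++ w (sigma ∷ []) α ⟨
    act r t (w ++ sigma ∷ []) α  ∎
    where
    open ≡-Reasoning
    σ∘f-ascends : Ascending (σ r t ∘ f)
    σ∘f-ascends α b = trans (sym (reflect-next _)) (cong (next ∘ reflect) (desc α b))
    decoded : Σ (List (Gen r)) λ w → ∀ α → σ r t (f α) ≡ act r t w α
    decoded = ascending⇒word (preservesS-act P (sigma ∷ [])) σ∘f-ascends
    w : List (Gen r)
    w = proj₁ decoded
    σ∘f≡ : ∀ α → σ r t (f α) ≡ act r t w α
    σ∘f≡ = proj₂ decoded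

  preservesS⇒word : ∀ {f} → PreservesS f → Σ (List (Gen r)) λ w → ∀ α → f α ≡ act r t w α
  preservesS⇒word P = [ ascending⇒word P , descending⇒word P ]′ (Orientation.ascending⊎descending P)

  -- Automorphisms of sC(r, s)

  record SquareThrough (C : Cycle) (A B : Vertex) : Set where
    field
      A' B'  : Vertex
      A'∈C   : A' ∈ᶜ C
      B'∈C   : B' ∈ᶜ C
      B~A'   : AdjC r t B A'
      A'~B'  : AdjC r t A' B'
      B'~A   : AdjC r t B' A
      A'≢A   : A' ≢ A
      B'≢B   : B' ≢ B

  squareThrough : ∀ C A B → A ∈ᶜ C → B ∈ᶜ C → AdjC r t A B → SquareThrough C A B
  squareThrough C A B A∈C B∈C adj with ∈-cases-side A C A∈C | ∈-cases-side B C B∈C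
  ... | e , a , refl | e' , b , refl with e BoolP.≟ e'
  ... | yes refl = ⊥-elim (adj⇒layer≢ adj (layer-side e C a b))
  ... | no e≢e' with BoolP.¬-not e≢e'
  ... | refl = record
    { A' = side (not e') C (not a) ; B' = side e' C (not b)
    ; A'∈C = ∈-side (not e') C (not a) ; B'∈C = ∈-side e' C (not b)
    ; B~A' = adj-sides e' C b (not a)
    ; A'~B' = adj-sym (adj-sides e' C (not b) (not a))
    ; B'~A = adj-sides e' C (not b) a
    ; A'≢A = λ eq → BoolP.not-¬ refl (sym (proj₂ (side-injective (not e') eq)))
    ; B'≢B = λ eq → BoolP.not-¬ refl (sym (proj₂ (side-injective e' eq))) }

  infix 4 _≟ᶜ_
  _≟ᶜ_ : (C D : Cycle) → Dec (C ≡ D)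
  _≟ᶜ_ = ProdP.≡-dec FinP._≟_ (VecP.≡-dec BoolP._≟_)

  otherCycle : Vertex → Cycle → Cycle
  otherCycle α C with C ≟ᶜ cycleˡ α
  ... | yes _ = cycleʳ α
  ... | no  _ = cycleˡ α

  ∈-otherCycle : ∀ α C → α ∈ᶜ otherCycle α C
  ∈-otherCycle α C with C ≟ᶜ cycleˡ α
  ... | yes _ = ∈-cycleʳ α
  ... | no  _ = ∈-cycleˡ α

  otherCycle-≢ : ∀ α C → C ≢ otherCycle α C
  otherCycle-≢ α C with C ≟ᶜ cycleˡ α
  ... | yes C≡ˡ = λ C≡ʳ → cycleˡ≢cycleʳ α (trans (sym C≡ˡ) C≡ʳ)
  ... | no  C≢ˡ = C≢ˡ

  otherCycle-unique : ∀ α C D → α ∈ᶜ C → α ∈ᶜ D → D ≢ C → D ≡ otherCycle α C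
  otherCycle-unique α C D α∈C α∈D D≢C with C ≟ᶜ cycleˡ α | ∈⇒cycleˡ⊎cycleʳ α D α∈D
  ... | yes C≡ˡ | inj₁ D≡ˡ = ⊥-elim (D≢C (trans D≡ˡ (sym C≡ˡ)))
  ... | yes _   | inj₂ D≡ʳ = D≡ʳ
  ... | no _    | inj₁ D≡ˡ = D≡ˡ
  ... | no C≢ˡ  | inj₂ D≡ʳ with ∈⇒cycleˡ⊎cycleʳ α C α∈C
  ... | inj₁ C≡ˡ = ⊥-elim (C≢ˡ C≡ˡ)
  ... | inj₂ C≡ʳ = ⊥-elim (D≢C (trans D≡ʳ (sym C≡ʳ)))

  -- The split graph is a union of copies of the cycles of S plus the perfect matching
  -- u ~ partner u joining the two copies of each vertex of C(r, s).
  partner : SplitVertex → SplitVertex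
  partner ((α , C) , _) = (α , otherCycle α C) , ∈-otherCycle α C

  adj-partner : ∀ u → AdjsC r t u (partner u)
  adj-partner ((α , C) , _) = inj₁ (otherCycle-≢ α C , refl)

  partner-unique : ∀ u v → vertex u ≡ vertex v → cycle u ≢ cycle v → v ≡ partner u
  partner-unique ((α , C) , α∈C) ((.α , D) , α∈D) refl C≢D =
    splitVertex-≡ refl (otherCycle-unique α C D α∈C α∈D (≢-sym C≢D))

  partner-involutive : ∀ u → partner (partner u) ≡ u
  partner-involutive u@((α , C) , _) = sym (partner-unique (partner u) u refl (≢-sym (otherCycle-≢ α C)))

  partner-edge-in-no-square : ∀ u v₁ v₂ → AdjsC r t (partner u) v₁ → AdjsC r t v₁ v₂ → AdjsC r t v₂ u →
                              v₁ ≢ u → v₂ ≢ partner u → ⊥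
  partner-edge-in-no-square u v₁ v₂ (inj₁ (C≢ , eq)) _ _ v₁≢u _ =
    v₁≢u (trans (partner-unique (partner u) v₁ eq C≢) (partner-involutive u))
  partner-edge-in-no-square u v₁ v₂ (inj₂ _) _ (inj₁ (C≢ , eq)) _ v₂≢u' =
    v₂≢u' (partner-unique u v₂ (sym eq) (≢-sym C≢))
  partner-edge-in-no-square ((α , C) , _) _ _ (inj₂ (C₁≡ , _)) (inj₂ (C₂≡ , _)) (inj₂ (C≡ , _)) _ _ =
    otherCycle-≢ α C (sym (trans (trans C₁≡ C₂≡) C≡))
  partner-edge-in-no-square ((α , C) , α∈C) ((β , C₁) , β∈C₁) ((.β , C₂) , β∈C₂)
                            (inj₂ (C₁≡ , α~β)) (inj₁ (_ , refl)) (inj₂ (C₂≡ , β~α)) _ _ =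
    otherCycle-≢ α C (edge-cycle-unique α β C (otherCycle α C) α~β α∈C (subst (β ∈ᶜ_) C₂≡ β∈C₂)
                                        (∈-otherCycle α C) (subst (β ∈ᶜ_) (sym C₁≡) β∈C₁))

  module Automorphism (φ : SplitVertex ↔ SplitVertex) (isAut : IsAutsC r t φ) where

    to from : SplitVertex → SplitVertex
    to   = Inverse.to φ
    from = Inverse.from φ

    to∘from : ∀ v → to (from v) ≡ v
    to∘from = Inverse.strictlyInverseˡ φ

    from∘to : ∀ u → from (to u) ≡ u
    from∘to = Inverse.strictlyInverseʳ φ

    to-injective : ∀ {u v} → to u ≡ to v → u ≡ v
    to-injective {u} {v} eq = trans (sym (from∘to u)) (trans (cong from eq) (from∘to v))

    to-adj : ∀ u v → AdjsC r t u v → AdjsC r t (to u) (to v)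
    to-adj u v = Equivalence.to (isAut u v)

    from-adj : ∀ v w → AdjsC r t v w → AdjsC r t (from v) (from w)
    from-adj v w adj = Equivalence.from (isAut (from v) (from w)) (subst₂ (AdjsC r t) (sym (to∘from v)) (sym (to∘from w)) adj)

    -- Otherwise the 4-cycle of S through the image edge pulls back to a 4-cycle through the
    -- partner edge, and there is none.
    partner-image-not-cycle-edge : ∀ u → cycle (to u) ≡ cycle (to (partner u)) →
                                   AdjC r t (vertex (to u)) (vertex (to (partner u))) → ⊥
    partner-image-not-cycle-edge u C≡ adj =
      partner-edge-in-no-square u (from X) (from Y) partner~X X~Y Y~u X≢u Y≢partner
      where
      C : Cycle
      C = cycle (to u)
      square : SquareThrough C (vertex (to u)) (vertex (to (partner u)))
      square = squareThrough C _ _ (proj₂ (to u)) (subst (vertex (to (partner u)) ∈ᶜ_) (sym C≡) (proj₂ (to (partner u)))) adj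
      open SquareThrough square
      X Y : SplitVertex
      X = (A' , C) , A'∈C
      Y = (B' , C) , B'∈C
      partner~X : AdjsC r t (partner u) (from X)
      partner~X = subst (λ z → AdjsC r t z (from X)) (from∘to (partner u)) (from-adj _ X (inj₂ (sym C≡ , B~A')))
      X~Y : AdjsC r t (from X) (from Y)
      X~Y = from-adj X Y (inj₂ (refl , A'~B'))
      Y~u : AdjsC r t (from Y) u
      Y~u = subst (AdjsC r t (from Y)) (from∘to u) (from-adj Y (to u) (inj₂ (refl , B'~A)))
      X≢u : from X ≢ u
      X≢u eq = A'≢A (cong vertex (trans (sym (to∘from X)) (cong to eq)))
      Y≢partner : from Y ≢ partner u
      Y≢partner eq = B'≢B (cong vertex (trans (sym (to∘from Y)) (cong to eq)))

    to-partner : ∀ u → to (partner u) ≡ partner (to u)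
    to-partner u with to-adj u (partner u) (adj-partner u)
    ... | inj₁ (C≢ , eq)  = partner-unique (to u) (to (partner u)) eq C≢
    ... | inj₂ (C≡ , adj) = ⊥-elim (partner-image-not-cycle-edge u C≡ adj)

    to-cycle-edge : ∀ u v → cycle u ≡ cycle v → AdjC r t (vertex u) (vertex v) →
                    cycle (to u) ≡ cycle (to v) × AdjC r t (vertex (to u)) (vertex (to v))
    to-cycle-edge u@((α , C) , _) v C≡ adj with to-adj u v (inj₂ (C≡ , adj))
    ... | inj₂ image-edge = image-edge
    ... | inj₁ (C≢ , eq) = ⊥-elim (otherCycle-≢ α C (trans C≡ (cong cycle
            (to-injective (trans (partner-unique (to u) (to v) eq C≢) (sym (to-partner u)))))))

    splitˡ : Vertex → SplitVertex
    splitˡ α = (α , cycleˡ α) , ∈-cycleˡ α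

    f : Vertex → Vertex
    f α = vertex (to (splitˡ α))

    vertex-to : ∀ u → vertex (to u) ≡ f (vertex u)
    vertex-to u@((α , C) , _) with C ≟ᶜ cycleˡ α
    ... | yes C≡ = cong (vertex ∘ to) (splitVertex-≡ refl C≡)
    ... | no  C≢ = cong vertex (trans (cong to (partner-unique (splitˡ α) u refl (C≢ ∘ sym))) (to-partner (splitˡ α)))

    f-injective : ∀ {α β} → f α ≡ f β → α ≡ β
    f-injective {α} {β} eq with cycle (to (splitˡ α)) ≟ᶜ cycle (to (splitˡ β))
    ... | yes C≡ = cong vertex (to-injective (splitVertex-≡ eq C≡))
    ... | no  C≢ = sym (cong vertex (to-injective
                     (trans (partner-unique (to (splitˡ α)) (to (splitˡ β)) eq C≢) (sym (to-partner (splitˡ α))))))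

    f-arc : ∀ α b → AdjC r t (f α) (f (step α b))
    f-arc α b = subst (AdjC r t (f α)) (vertex-to (_ , step-∈-cycleˡ α b))
      (proj₂ (to-cycle-edge (splitˡ α) ((step α b , cycleˡ α) , step-∈-cycleˡ α b) refl (adj-step α b)))

    f-adj : ∀ α β → AdjC r t α β → AdjC r t (f α) (f β)
    f-adj α β (inj₁ α→β) with arc⇒step α→β
    ... | b , refl = f-arc α b
    f-adj α β (inj₂ β→α) with arc⇒step β→α
    ... | b , refl = adj-sym (f-arc β b)

    image : Cycle → Cycle
    image C = cycle (to ((left C false , C) , ∈-left C false))

    cycle-to : ∀ u → cycle (to u) ≡ image (cycle u)
    cycle-to ((γ , C) , γ∈C) with ∈-cases γ C γ∈C
    ... | inj₁ (a , refl) = trans (proj₁ (to-cycle-edge (_ , γ∈C) right₀ refl (adj-sides true C a false)))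
                                  (sym (proj₁ (to-cycle-edge left₀ right₀ refl (adj-sides true C false false))))
      where
      left₀ right₀ : SplitVertex
      left₀  = (left C false , C) , ∈-left C false
      right₀ = (right C false , C) , ∈-right C false
    ... | inj₂ (b , refl) =
      sym (proj₁ (to-cycle-edge ((left C false , C) , ∈-left C false) (_ , γ∈C) refl (adj-sides true C false b)))

    preservesS : PreservesS f
    preservesS = record
      { injective = f-injective
      ; adjacent  = f-adj
      ; image     = image
      ; ∈-image   = λ γ C γ∈C →
          subst₂ _∈ᶜ_ (vertex-to (_ , γ∈C)) (cycle-to (_ , γ∈C)) (proj₂ (to ((γ , C) , γ∈C))) }

    word : List (Gen r)
    word = proj₁ (preservesS⇒word preservesS)

    symmetry : Symmetry
    symmetry = wordSymmetry word

    onV≡f : ∀ α → onV symmetry α ≡ f α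
    onV≡f α = trans (onV-wordSymmetry word α) (sym (proj₂ (preservesS⇒word preservesS) α))

    image≡onC : ∀ C → image C ≡ onC symmetry C
    image≡onC C = edge-cycle-unique (f (left C false)) (f (right C false)) (image C) (onC symmetry C)
      (f-adj _ _ (adj-sides true C false false))
      (PreservesS.∈-image preservesS _ C (∈-left C false))
      (PreservesS.∈-image preservesS _ C (∈-right C false))
      (subst (_∈ᶜ onC symmetry C) (onV≡f _) (sideMap-∈ (sides symmetry) _ C (∈-left C false)))
      (subst (_∈ᶜ onC symmetry C) (onV≡f _) (sideMap-∈ (sides symmetry) _ C (∈-right C false)))

    induced-by-word : Induces r t (act r t word) φ
    induced-by-word u@((α , C) , _) = trans (vertex-to u) (proj₂ (preservesS⇒word preservesS) α) , λ γ → mk⇔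
      (λ γ∈C → subst₂ _∈ᶜ_ (onV-wordSymmetry word γ) (sym C≡) (sideMap-∈ (sides symmetry) γ C γ∈C))
      (λ γ∈C' → ∈-onV⁻¹ symmetry γ C (subst₂ _∈ᶜ_ (sym (onV-wordSymmetry word γ)) C≡ γ∈C'))
      where
      C≡ : cycle (to u) ≡ onC symmetry C
      C≡ = trans (cycle-to u) (image≡onC C)

  -- Transitivity

  flips-++ : ∀ w v → flips (wordSymmetry (w ++ v)) ≡ flips (wordSymmetry w) xor flips (wordSymmetry v)
  flips-++ []      v = refl
  flips-++ (g ∷ w) v = trans (cong (flips (genSymmetry g) xor_) (flips-++ w v))
    (sym (BoolP.xor-assoc (flips (genSymmetry g)) (flips (wordSymmetry w)) (flips (wordSymmetry v))))

  flips-ρ^ : ∀ m → flips (wordSymmetry (List.replicate m rho)) ≡ false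
  flips-ρ^ zero    = refl
  flips-ρ^ (suc m) = flips-ρ^ m

  flips-τ* : ∀ L → flips (wordSymmetry (List.map tau L)) ≡ false
  flips-τ* []      = refl
  flips-τ* (i ∷ L) = flips-τ* L

  module Transitivity (s≤r : suc t ≤ r) where

    -- τ_p has to flip bit p - x of ε; these offsets are distinct because s ≤ r.
    correction : Fin r → Str r t → Str r t → Fin r → Bool
    correction x ε ε' p = bitAt (zipWith _xor_ ε ε') (toℕ (modr r (toℕ p + (r ∸ toℕ x))))

    toℕ-offset : ∀ x (j : Fin (suc t)) → toℕ (modr r (toℕ (position x j) + (r ∸ toℕ x))) ≡ toℕ j
    toℕ-offset x j = <r-≈⇒≡ (FinP.toℕ<n _) (≤-trans (FinP.toℕ<n j) s≤r) (begin
      toℕ (modr r (toℕ (position x j) + (r ∸ toℕ x)))   ≈⟨ toℕ-modr-≈ _ ⟩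
      toℕ (position x j) + (r ∸ toℕ x)                  ≈⟨ +-cong-≈ (toℕ-modr-≈ _) refl ⟩
      toℕ x + toℕ j + (r ∸ toℕ x)                        ≡⟨ +-rearrange (toℕ x) (r ∸ toℕ x) (toℕ j) ⟨
      toℕ x + ((r ∸ toℕ x) + toℕ j)                      ≡⟨ +-assoc (toℕ x) _ _ ⟨
      toℕ x + (r ∸ toℕ x) + toℕ j                        ≡⟨ cong (_+ toℕ j) (m+[n∸m]≡n (<⇒≤ (FinP.toℕ<n x))) ⟩
      r + toℕ j                                          ≡⟨ +-comm r (toℕ j) ⟩
      toℕ j + r                                          ≈⟨ +r≈ (toℕ j) ⟩
      toℕ j                                              ∎)
      where open ≈-Reasoning

    act-correction : ∀ x ε ε' → act r t (flipWord (correction x ε ε')) (x , ε) ≡ (x , ε')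
    act-correction x ε ε' = trans (act-flipWord _ x ε) (cong (x ,_) (lookup-ext _ _ λ j → begin
      lookup (tabulate λ j → lookup ε j xor correction x ε ε' (position x j)) j
        ≡⟨ VecP.lookup∘tabulate (λ j → lookup ε j xor correction x ε ε' (position x j)) j ⟩
      lookup ε j xor bitAt (zipWith _xor_ ε ε') (toℕ (modr r (toℕ (position x j) + (r ∸ toℕ x))))
        ≡⟨ cong (λ k → lookup ε j xor bitAt (zipWith _xor_ ε ε') k) (toℕ-offset x j) ⟩
      lookup ε j xor bitAt (zipWith _xor_ ε ε') (toℕ j)
        ≡⟨ cong (lookup ε j xor_) (trans (bitAt-lookup (zipWith _xor_ ε ε') j) (VecP.lookup-zipWith _xor_ j ε ε')) ⟩
      lookup ε j xor (lookup ε j xor lookup ε' j)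
        ≡⟨ xor-cancelˡ (lookup ε j) (lookup ε' j) ⟩
      lookup ε' j ∎))
      where open ≡-Reasoning

    orientWord : Bool → List (Gen r)
    orientWord false = []
    orientWord true  = sigma ∷ []

    flips-orientWord : ∀ fl → flips (wordSymmetry (orientWord fl)) ≡ fl
    flips-orientWord false = refl
    flips-orientWord true  = refl

    vertex-transitive : ∀ α β fl → Σ (List (Gen r)) λ w → onV (wordSymmetry w) α ≡ β × flips (wordSymmetry w) ≡ fl
    vertex-transitive α β fl = w , onV≡β , flips≡fl
      where
      α₁ : Vertex
      α₁ = act r t (orientWord fl) α
      k : ℕ
      k = toℕ (layer β) + (r ∸ toℕ (layer α₁))
      rotate : List (Gen r)
      rotate = List.replicate k rho
      fix : Fin r → Bool
      fix = correction (layer β) (proj₂ α₁) (proj₂ β)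
      w : List (Gen r)
      w = orientWord fl ++ rotate ++ flipWord fix

      onV≡β : onV (wordSymmetry w) α ≡ β
      onV≡β = begin
        onV (wordSymmetry w) α                                 ≡⟨ onV-wordSymmetry w α ⟩
        act r t w α                                            ≡⟨ act-++ (orientWord fl) _ α ⟩
        act r t (rotate ++ flipWord fix) α₁                    ≡⟨ act-++ rotate _ α₁ ⟩
        act r t (flipWord fix) (act r t rotate α₁)
          ≡⟨ cong (act r t (flipWord fix)) (act-ρ^ k (layer α₁) (proj₂ α₁)) ⟩
        act r t (flipWord fix) (next^ k (layer α₁) , proj₂ α₁) ≡⟨ cong (λ x → act r t (flipWord fix) (x , proj₂ α₁))
                                                                      (next^-reach (layer α₁) (layer β)) ⟩
        act r t (flipWord fix) (layer β , proj₂ α₁)            ≡⟨ act-correction (layer β) (proj₂ α₁) (proj₂ β) ⟩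
        β                                                      ∎
        where open ≡-Reasoning

      flips≡fl : flips (wordSymmetry w) ≡ fl
      flips≡fl = begin
        flips (wordSymmetry w)
          ≡⟨ flips-++ (orientWord fl) _ ⟩
        flips (wordSymmetry (orientWord fl)) xor flips (wordSymmetry (rotate ++ flipWord fix))
          ≡⟨ cong₂ _xor_ (flips-orientWord fl)
                         (trans (flips-++ rotate _) (cong₂ _xor_ (flips-ρ^ k) (flips-τ* (List.filterᵇ fix (List.allFin r))))) ⟩
        fl xor false
          ≡⟨ BoolP.xor-identityʳ fl ⟩
        fl ∎
        where open ≡-Reasoning

    transitive : ∀ u v → Σ (List (Gen r)) λ w → Σ (SplitVertex ↔ SplitVertex) λ φ →
                 Induces r t (act r t w) φ × (Inverse.to φ u ≡ v)
    transitive ((α , C) , α∈C) ((β , D) , β∈D) with ∈-cases-side α C α∈C | ∈-cases-side β D β∈D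
    ... | e , a , refl | e' , b , refl with vertex-transitive (side e C a) (side e' D b) (e xor e')
    ... | w , onV≡ , flips≡ = w , induced↔ (wordSymmetry w) , proj₂ (proj₂ (word-automorphism w)) ,
      splitVertex-≡ onV≡ (onC-from-side (wordSymmetry w) e C a e' D b onV≡ (trans (cong (e xor_) flips≡) (xor-cancelˡ e e')))

lemma2p10 : (r t : ℕ) {{_ : NonZero r}} → 3 ≤ r → 1 ≤ suc t → suc t ≤ r ∸ 1 →
    ((w : List (Gen r)) → Σ (VsC r t ↔ VsC r t) λ φ → IsAutsC r t φ × Induces r t (act r t w) φ)
    × ((φ : VsC r t ↔ VsC r t) → IsAutsC r t φ → Σ (List (Gen r)) λ w → Induces r t (act r t w) φ)
    × ((u v : VsC r t) → Σ (List (Gen r)) λ w → Σ (VsC r t ↔ VsC r t) λ φ →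
         Induces r t (act r t w) φ × (Inverse.to φ u ≡ v))
lemma2p10 r t r≥3 _ s≤r∸1 =
  word-automorphism , (λ φ isAut → word φ isAut , induced-by-word φ isAut) , transitive
  where
  open PraegerXu r t r≥3
  open Automorphism using (word; induced-by-word)
  -- s ≥ 1 holds by construction (s = t + 1), and of s ≤ r - 1 only s ≤ r is needed.
  open Transitivity (≤-trans s≤r∸1 (m∸n≤m r 1))
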